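{- (1) There exist $2^{\aleph_0}$ complete folding sequences which are pairwise not locally isomorphic. (2) For each complete folding sequence $S$, there exist $2^{\aleph_0}$ isomorphism classes of sequences $(b_h)_{h\in\mathbb{Z}}\subset\{+1,-1\}$ which are locally isomorphic to $S$.
   Context: All sequences take values in $\{+1,-1\}$. For $S=(a_1,\dots,a_n)$ write $\overline{S}=(-a_n,\dots,-a_1)$. The $n$-folding sequences are defined recursively: the only $0$-folding sequence is the empty sequence, and the $(n+1)$-folding sequences are exactly $(\overline{S},+1,S)$ and $(\overline{S},-1,S)$ with $S$ an $n$-folding sequence. A finite sequence $(u_1,\dots,u_m)$ is a subword of a sequence $(b_k)$ if there is $h$ with $u_k=b_{k+h}$ for $1\le k\le m$. A complete folding sequence is a sequence $(a_k)_{k\in\mathbb{Z}}$ each finite subword of which is a subword of some $n$-folding sequence. Two sequences $(a_h)_{h\in\mathbb{Z}},(b_h)_{h\in\mathbb{Z}}$ are isomorphic if there is $k\in\mathbb{Z}$ with $b_h=a_{h+k}$ for all $h$, and locally isomorphic if they have the same finite subwords. -}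

module Defs where

open import Data.Sign using (Sign; opposite) public
open import Data.Nat using (ℕ; zero; suc)
open import Data.Integer using (ℤ; _+_; +_)
open import Data.List using (List; []; _∷_; _++_; reverse; map; length)
open import Data.Product using (Σ; ∃; _×_; _,_)
open import Data.Bool using (Bool)
open import Relation.Binary.PropositionalEquality using (_≡_)
open import Function.Bundles using (_⇔_)

-- Values ±1 are represented by Data.Sign.Sign (+ ↦ +1, - ↦ -1).

Word : Set
Word = List Sign

Seq : Set
Seq = ℤ → Sign

bar : Word → Word
bar S = reverse (map opposite S)

data IsFolding : ℕ → Word → Set where
  fold-zero : IsFolding zero []
  fold-suc  : ∀ {n S} → IsFolding n S → (s : Sign) →
              IsFolding (suc n) (bar S ++ (s ∷ S))

SubwordFin : Word → Word → Set
SubwordFin u b = Σ Word λ p → Σ Word λ q → b ≡ p ++ (u ++ q)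

window : Seq → ℤ → ℕ → Word
window a h zero    = []
window a h (suc m) = a h ∷ window a (h + + 1) m

Subword : Word → Seq → Set
Subword u a = Σ ℤ λ h → window a h (length u) ≡ u

IsCompleteFolding : Seq → Set
IsCompleteFolding a =
  ∀ (u : Word) → Subword u a →
    Σ ℕ λ n → Σ Word λ S → IsFolding n S × SubwordFin u S

Isomorphic : Seq → Seq → Set
Isomorphic a b = Σ ℤ λ k → ∀ (h : ℤ) → b h ≡ a (h + k)

LocallyIsomorphic : Seq → Seq → Set
LocallyIsomorphic a b = ∀ (u : Word) → Subword u a ⇔ Subword u b

-- Cantor space, indexing 2^ℵ0 many objects
Cantor : Set
Cantor = ℕ → Bool

_≈c_ : Cantor → Cantor → Set
α ≈c β = ∀ n → α n ≡ β n

module Submission where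

-- For fold instructions t : ℕ → Sign, canon t is given by canon t (2k+1) =
-- t₀(-1)^k and canon t (2k) = canon (tail t) k.  (1) canon t is complete
-- (interleaving preserves folding sequences) and, as odd places are locally
-- recognisable, a long window of canon t determines each t j.  (2) Folding
-- sequences are windows of canonical ones, so S is locally canonical and has
-- a decomposition into levels alternating on offset classes; its local
-- isomorphism class depends only on an invariant sign sequence.  Realising
-- offsets that encode α with the invariant of S gives G α locally isomorphic
-- to S, and an isomorphism G α ≅ G β descends through the levels as a halving
-- shift, forcing the offsets, hence α and β, to agree.

open import Defs
open import Data.Sign as Sign using (Sign; opposite) renaming (_*_ to _·_)
import Data.Sign.Properties as Sign
open import Data.Nat as ℕ using (ℕ; zero; suc; _≤_; _<_; z≤n; s≤s; _^_; _∸_; _≡ᵇ_; _<ᵇ_; ⌈_/2⌉)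
import Data.Nat.Properties as ℕ
open import Data.Nat.Induction using (<-rec)
open import Data.Integer as ℤ using (ℤ; +_; -[1+_]; _+_; _-_; -_; ∣_∣)
import Data.Integer.Properties as ℤ
open import Data.Integer.Tactic.RingSolver using (solve-∀)
open import Data.Bool using (Bool; true; false; not; T; if_then_else_)
import Data.Bool.Properties as Bool
open import Data.List using (List; []; _∷_; _++_; reverse; map; length)
import Data.List.Properties as List
open import Data.Product using (Σ; _×_; _,_; proj₁; proj₂)
open import Data.Sum using (_⊎_; inj₁; inj₂)
open import Data.Empty using (⊥; ⊥-elim)
open import Function.Bundles using (Equivalence; mk⇔)
open import Relation.Binary.PropositionalEquality
open import Relation.Nullary using (¬_; yes; no)

·-opposite : ∀ s t → s · opposite t ≡ opposite (s · t)
·-opposite Sign.+ t = refl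
·-opposite Sign.- t = refl

·-cancel-self : ∀ s t → s · (s · t) ≡ t
·-cancel-self s t = trans (sym (Sign.*-assoc s s t)) (cong (_· t) (Sign.s*s≡+ s))

ℤ-ind : (P : ℤ → Set) → P (+ 0) → (∀ x → P x → P (x + + 1)) →
        (∀ x → P x → P (x - + 1)) → ∀ x → P x
ℤ-ind P p0 up down (+ zero)      = p0
ℤ-ind P p0 up down (+ suc n)     =
  subst P (cong +_ (ℕ.+-comm n 1)) (up (+ n) (ℤ-ind P p0 up down (+ n)))
ℤ-ind P p0 up down -[1+ zero ]   = down (+ 0) p0
ℤ-ind P p0 up down -[1+ suc n ]  =
  subst P (cong (λ k → -[1+ suc k ]) (ℕ.+-identityʳ n))
        (down -[1+ n ] (ℤ-ind P p0 up down -[1+ n ]))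

-- alt x = (-1)^x, a homomorphism from (ℤ,+) to the sign group.

altℕ : ℕ → Sign
altℕ zero    = Sign.+
altℕ (suc n) = opposite (altℕ n)

alt : ℤ → Sign
alt (+ n)     = altℕ n
alt -[1+ n ]  = altℕ (suc n)

alt-suc : ∀ x → alt (x + + 1) ≡ opposite (alt x)
alt-suc (+ n)           = cong altℕ (ℕ.+-comm n 1)
alt-suc -[1+ zero ]     = refl
alt-suc -[1+ suc n ]    = sym (Sign.opposite-involutive _)

Flips : (ℤ → Sign) → Set
Flips f = ∀ m → f (m + + 1) ≡ opposite (f m)

flips-backwards : ∀ f → Flips f → ∀ m → f (m - + 1) ≡ opposite (f m)
flips-backwards f flips m = begin
  f (m - + 1)                       ≡⟨ Sign.opposite-involutive _ ⟨
  opposite (opposite (f (m - + 1))) ≡⟨ cong opposite (flips (m - + 1)) ⟨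
  opposite (f (m - + 1 + + 1))      ≡⟨ cong (λ y → opposite (f y)) (pred-suc m) ⟩
  opposite (f m)                    ∎
  where
    open ≡-Reasoning
    pred-suc : ∀ m → m - + 1 + + 1 ≡ m
    pred-suc = solve-∀

alt-pred : ∀ x → alt (x - + 1) ≡ opposite (alt x)
alt-pred = flips-backwards alt alt-suc

flips⇒alt : ∀ f → Flips f → ∀ m → f m ≡ f (+ 0) · alt m
flips⇒alt f flips = ℤ-ind (λ m → f m ≡ f (+ 0) · alt m)
  (sym (Sign.*-identityʳ _))
  (λ m ih → step m (flips m) (alt-suc m) ih)
  (λ m ih → step m (flips-backwards f flips m) (alt-pred m) ih)
  where
    step : ∀ m {m'} → f m' ≡ opposite (f m) → alt m' ≡ opposite (alt m) →
           f m ≡ f (+ 0) · alt m → f m' ≡ f (+ 0) · alt m'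
    step m e ea ih = trans e (trans (cong opposite ih)
                       (trans (sym (·-opposite (f (+ 0)) (alt m))) (cong (f (+ 0) ·_) (sym ea))))

alt-+ : ∀ x y → alt (x + y) ≡ alt x · alt y
alt-+ x y = trans (flips⇒alt (λ z → alt (x + z)) flips y)
                  (cong (_· alt y) (cong alt (ℤ.+-identityʳ x)))
  where
    flips : Flips (λ z → alt (x + z))
    flips z = trans (cong alt (sym (ℤ.+-assoc x z (+ 1)))) (alt-suc (x + z))

alt-double : ∀ k → alt (k + k) ≡ Sign.+
alt-double k = trans (alt-+ k k) (Sign.s*s≡+ (alt k))

alt-odd : ∀ k → alt (k + k + + 1) ≡ Sign.-
alt-odd k = trans (alt-suc (k + k)) (cong opposite (alt-double k))

alt-neg : ∀ x → alt (- x) ≡ alt x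
alt-neg x = Sign.*-cancelˡ-≡ (alt x) (alt (- x)) (alt x)
  (trans (sym (alt-+ x (- x))) (trans (cong alt (ℤ.+-inverseʳ x)) (sym (Sign.s*s≡+ (alt x)))))

alt-- : ∀ x y → alt (x - y) ≡ alt x · alt y
alt-- x y = trans (alt-+ x (- y)) (cong (alt x ·_) (alt-neg y))

data Parity : ℤ → Set where
  even : ∀ k → Parity (k + k)
  odd  : ∀ k → Parity (k + k + + 1)

parity : ∀ x → Parity x
parity = ℤ-ind Parity (even (+ 0)) up down
  where
    up : ∀ x → Parity x → Parity (x + + 1)
    up _ (even k) = odd k
    up _ (odd k)  = subst Parity (sym (l k)) (even (k + + 1))
      where l : ∀ k → k + k + + 1 + + 1 ≡ (k + + 1) + (k + + 1)
            l = solve-∀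
    down : ∀ x → Parity x → Parity (x - + 1)
    down _ (even k) = subst Parity (sym (l k)) (odd (k - + 1))
      where l : ∀ k → k + k - + 1 ≡ (k - + 1) + (k - + 1) + + 1
            l = solve-∀
    down _ (odd k)  = subst Parity (sym (l k)) (even k)
      where l : ∀ k → k + k + + 1 - + 1 ≡ k + k
            l = solve-∀

even≢odd : ∀ k m → k + k ≢ m + m + + 1
even≢odd k m e with trans (sym (alt-double k)) (trans (cong alt e) (alt-odd m))
... | ()

+-cancelʳ : ∀ a b c → a + c ≡ b + c → a ≡ b
+-cancelʳ a b c e = trans (sym (l a c)) (trans (cong (_- c) e) (l b c))
  where l : ∀ x y → x + y - y ≡ x
        l = solve-∀

double-injective : ∀ k m → k + k ≡ m + m → k ≡ m
double-injective k m e = ℤ.*-cancelˡ-≡ (+ 2) k m (trans (l k) (trans e (sym (l m))))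
  where l : ∀ z → + 2 ℤ.* z ≡ z + z
        l = solve-∀

-- halve x = (k , b) with x = 2k + b; it drives the recursive definitions of
-- sequences, since it computes on every integer.

bit : Bool → ℤ
bit false = + 0
bit true  = + 1

unhalve : ℤ × Bool → ℤ
unhalve (k , b) = k + k + bit b

halve : ℤ → ℤ × Bool
halve x with parity x
... | even k = k , false
... | odd k  = k , true

halve-spec : ∀ x → x ≡ unhalve (halve x)
halve-spec x with parity x
... | even k = sym (ℤ.+-identityʳ (k + k))
... | odd k  = refl

unhalve-injective : ∀ p q → unhalve p ≡ unhalve q → p ≡ q
unhalve-injective (k , false) (m , false) e =
  cong (_, false) (double-injective k m (+-cancelʳ (k + k) (m + m) (+ 0) e))
unhalve-injective (k , false) (m , true)  e = ⊥-elim (even≢odd k m (trans (sym (ℤ.+-identityʳ _)) e))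
unhalve-injective (k , true)  (m , false) e = ⊥-elim (even≢odd m k (trans (sym (ℤ.+-identityʳ _)) (sym e)))
unhalve-injective (k , true)  (m , true)  e =
  cong (_, true) (double-injective k m (+-cancelʳ (k + k) (m + m) (+ 1) e))

halve-even : ∀ k → halve (k + k) ≡ (k , false)
halve-even k = unhalve-injective _ _ (trans (sym (halve-spec (k + k))) (sym (ℤ.+-identityʳ _)))

halve-odd : ∀ k → halve (k + k + + 1) ≡ (k , true)
halve-odd k = unhalve-injective _ _ (sym (halve-spec (k + k + + 1)))

halving-< : ∀ a X c → a ℕ.+ a ≤ X ℕ.+ c → c < X → a < X
halving-< a X c le c<X = ℕ.≰⇒> λ X≤a → ℕ.<-irrefl refl
  (ℕ.<-≤-trans (ℕ.+-monoʳ-< X c<X) (ℕ.≤-trans (ℕ.+-mono-≤ X≤a X≤a) le))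

∣double∣ : ∀ k → ∣ k + k ∣ ≡ ∣ k ∣ ℕ.+ ∣ k ∣
∣double∣ (+ n)     = refl
∣double∣ -[1+ n ]  = cong suc (sym (ℕ.+-suc n n))

-- Two bi-infinite sequences agree on L consecutive places starting at x resp. y.
-- (A record, so that the sequences and offsets can be inferred.)

record Agree (a b : Seq) (x y : ℤ) (L : ℕ) : Set where
  constructor agree
  field at : ∀ i → i < L → a (x + + i) ≡ b (y + + i)
open Agree public

Agree-sym : ∀ {a b x y L} → Agree a b x y L → Agree b a y x L
Agree-sym ag = agree λ i i<L → sym (at ag i i<L)

Agree-≤ : ∀ {a b x y L L'} → L' ≤ L → Agree a b x y L → Agree a b x y L'
Agree-≤ le ag = agree λ i i<L' → at ag i (ℕ.<-≤-trans i<L' le)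

Agree-single : ∀ {a b x y} → a x ≡ b y → Agree a b x y 1
Agree-single {a} {b} {x} {y} e = agree λ where
  zero    _           → trans (cong a (ℤ.+-identityʳ x)) (trans e (cong b (sym (ℤ.+-identityʳ y))))
  (suc i) (s≤s ())

Agree-drop : ∀ {a b x y} L k → Agree a b x y (k ℕ.+ L) → Agree a b (x + + k) (y + + k) L
Agree-drop {a} {b} {x} {y} L k ag = agree λ i i<L →
  trans (cong a (ℤ.+-assoc x (+ k) (+ i)))
        (trans (at ag (k ℕ.+ i) (ℕ.+-monoʳ-< k i<L)) (cong b (sym (ℤ.+-assoc y (+ k) (+ i)))))

window-length : ∀ a h m → length (window a h m) ≡ m
window-length a h zero    = refl
window-length a h (suc m) = cong suc (window-length a (h + + 1) m)

+1+ : ∀ h i → h + + 1 + + i ≡ h + + suc i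
+1+ h i = ℤ.+-assoc h (+ 1) (+ i)

window-agree : ∀ {a b x y} L → Agree a b x y L → window a x L ≡ window b y L
window-agree zero    ag = refl
window-agree {a} {b} {x} {y} (suc L) ag =
  cong₂ _∷_ (trans (cong a (sym (ℤ.+-identityʳ x)))
                   (trans (at ag 0 (s≤s z≤n)) (cong b (ℤ.+-identityʳ y))))
            (window-agree L (agree λ i i<L →
              trans (cong a (+1+ x i)) (trans (at ag (suc i) (s≤s i<L)) (cong b (sym (+1+ y i))))))

agree-window : ∀ a b x y L → window a x L ≡ window b y L → Agree a b x y L
agree-window a b x y L e = agree (pointwise L x y e)
  where
    pointwise : ∀ L x y → window a x L ≡ window b y L → ∀ i → i < L → a (x + + i) ≡ b (y + + i)
    pointwise (suc L) x y e zero _ =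
      trans (cong a (ℤ.+-identityʳ x)) (trans (List.∷-injectiveˡ e) (cong b (sym (ℤ.+-identityʳ y))))
    pointwise (suc L) x y e (suc i) (s≤s i<L) =
      trans (cong a (sym (+1+ x i)))
            (trans (pointwise L (x + + 1) (y + + 1) (List.∷-injectiveʳ e) i i<L) (cong b (+1+ y i)))

window-++ : ∀ a h m n → window a h (m ℕ.+ n) ≡ window a h m ++ window a (h + + m) n
window-++ a h zero    n = cong (λ z → window a z n) (sym (ℤ.+-identityʳ h))
window-++ a h (suc m) n = cong (a h ∷_) (trans (window-++ a (h + + 1) m n)
  (cong (λ z → window a (h + + 1) m ++ window a z n) (+1+ h m)))

window-transfer : ∀ {a b} → LocallyIsomorphic a b → ∀ x L → Σ ℤ λ y → Agree a b x y L
window-transfer {a} {b} li x L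
  with Equivalence.to (li (window a x L)) (x , cong (window a x) (window-length a x L))
... | y , e = y , Agree-sym (agree-window b a y x L (trans (cong (window b y) (sym (window-length a x L))) e))

subword-refl : ∀ u → SubwordFin u u
subword-refl u = [] , [] , sym (List.++-identityʳ u)

subword-trans : ∀ {u v w} → SubwordFin u v → SubwordFin v w → SubwordFin u w
subword-trans {u} (p , q , refl) (p' , q' , refl) = p' ++ p , q ++ q' , (begin
  p' ++ ((p ++ (u ++ q)) ++ q')   ≡⟨ cong (p' ++_) (List.++-assoc p (u ++ q) q') ⟩
  p' ++ (p ++ ((u ++ q) ++ q'))   ≡⟨ List.++-assoc p' p _ ⟨
  (p' ++ p) ++ ((u ++ q) ++ q')   ≡⟨ cong ((p' ++ p) ++_) (List.++-assoc u q q') ⟩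
  (p' ++ p) ++ (u ++ (q ++ q'))   ∎)
  where open ≡-Reasoning

window-subword : ∀ a x off L r h → x + + off ≡ h →
                 SubwordFin (window a h L) (window a x (off ℕ.+ (L ℕ.+ r)))
window-subword a x off L r h e = window a x off , window a (h + + L) r ,
  trans (window-++ a x off (L ℕ.+ r))
        (cong (window a x off ++_) (trans (cong (λ z → window a z (L ℕ.+ r)) e) (window-++ a h L r)))

opp^ : ℕ → Sign → Sign
opp^ zero    s = s
opp^ (suc n) s = opp^ n (opposite s)

opp^-opposite : ∀ n s → opp^ n (opposite s) ≡ opposite (opp^ n s)
opp^-opposite zero    s = refl
opp^-opposite (suc n) s = opp^-opposite n (opposite s)

opp^-involutive : ∀ n s → opp^ n (opp^ n s) ≡ s
opp^-involutive zero    s = refl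
opp^-involutive (suc n) s = begin
  opp^ n (opposite (opp^ n (opposite s))) ≡⟨ cong (λ z → opp^ n (opposite z)) (opp^-opposite n s) ⟩
  opp^ n (opposite (opposite (opp^ n s))) ≡⟨ cong (opp^ n) (Sign.opposite-involutive _) ⟩
  opp^ n (opp^ n s)                       ≡⟨ opp^-involutive n s ⟩
  s                                       ∎
  where open ≡-Reasoning

opp^-+ : ∀ m n s → opp^ (m ℕ.+ n) s ≡ opp^ n (opp^ m s)
opp^-+ zero    n s = refl
opp^-+ (suc m) n s = opp^-+ m n (opposite s)

-- This is how
-- an (n+1)-folding sequence arises from an n-folding sequence.

interleave₀ : Sign → Word → Word
interleave₀ σ []      = []
interleave₀ σ (b ∷ w) = σ ∷ b ∷ interleave₀ (opposite σ) w

interleave : Sign → Word → Word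
interleave σ w = interleave₀ σ w ++ (opp^ (length w) σ ∷ [])

interleave₀-++ : ∀ σ w v → interleave₀ σ (w ++ v) ≡ interleave₀ σ w ++ interleave₀ (opp^ (length w) σ) v
interleave₀-++ σ []      v = refl
interleave₀-++ σ (b ∷ w) v = cong (λ z → σ ∷ b ∷ z) (interleave₀-++ (opposite σ) w v)

interleave-++ : ∀ σ w v → interleave σ (w ++ v) ≡ interleave₀ σ w ++ interleave (opp^ (length w) σ) v
interleave-++ σ w v = begin
  interleave₀ σ (w ++ v) ++ (opp^ (length (w ++ v)) σ ∷ [])
    ≡⟨ cong₂ _++_ (interleave₀-++ σ w v) (cong (λ n → opp^ n σ ∷ []) (List.length-++ w)) ⟩
  (interleave₀ σ w ++ interleave₀ σ' v) ++ (opp^ (length w ℕ.+ length v) σ ∷ [])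
    ≡⟨ List.++-assoc (interleave₀ σ w) _ _ ⟩
  interleave₀ σ w ++ (interleave₀ σ' v ++ (opp^ (length w ℕ.+ length v) σ ∷ []))
    ≡⟨ cong (λ z → interleave₀ σ w ++ (interleave₀ σ' v ++ (z ∷ []))) (opp^-+ (length w) (length v) σ) ⟩
  interleave₀ σ w ++ interleave σ' v ∎
  where
    open ≡-Reasoning
    σ' = opp^ (length w) σ

interleave-head : ∀ τ q → Σ Word λ r → interleave τ q ≡ τ ∷ r
interleave-head τ []      = [] , refl
interleave-head τ (b ∷ q) = _ , refl

interleave-subword : ∀ {W T} → SubwordFin W T → ∀ σ →
                     Σ Sign λ σ' → SubwordFin (interleave σ W) (interleave σ' T)
interleave-subword {W} (p , q , refl) σ = σ' , interleave₀ σ' p , proj₁ (interleave-head τ q) , (begin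
  interleave σ' (p ++ (W ++ q))
    ≡⟨ interleave-++ σ' p (W ++ q) ⟩
  interleave₀ σ' p ++ interleave (opp^ (length p) σ') (W ++ q)
    ≡⟨ cong (λ z → interleave₀ σ' p ++ interleave z (W ++ q)) (opp^-involutive (length p) σ) ⟩
  interleave₀ σ' p ++ interleave σ (W ++ q)
    ≡⟨ cong (interleave₀ σ' p ++_) (interleave-++ σ W q) ⟩
  interleave₀ σ' p ++ (interleave₀ σ W ++ interleave τ q)
    ≡⟨ cong (λ z → interleave₀ σ' p ++ (interleave₀ σ W ++ z)) (proj₂ (interleave-head τ q)) ⟩
  interleave₀ σ' p ++ (interleave₀ σ W ++ (τ ∷ proj₁ (interleave-head τ q)))
    ≡⟨ cong (interleave₀ σ' p ++_) (List.++-assoc (interleave₀ σ W) (τ ∷ []) _) ⟨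
  interleave₀ σ' p ++ (interleave σ W ++ proj₁ (interleave-head τ q)) ∎)
  where
    open ≡-Reasoning
    σ' = opp^ (length p) σ
    τ  = opp^ (length W) σ

bar-++ : ∀ w v → bar (w ++ v) ≡ bar v ++ bar w
bar-++ w v = trans (cong reverse (List.map-++ opposite w v)) (List.reverse-++ (map opposite w) (map opposite v))

bar-∷ : ∀ x w → bar (x ∷ w) ≡ bar w ++ (opposite x ∷ [])
bar-∷ x = bar-++ (x ∷ [])

bar-length : ∀ w → length (bar w) ≡ length w
bar-length w = trans (List.length-reverse (map opposite w)) (List.length-map opposite w)

bar-interleave : ∀ τ w → bar (interleave τ w) ≡ interleave (opposite (opp^ (length w) τ)) (bar w)
bar-interleave τ []      = refl
bar-interleave τ (b ∷ w) = begin
  bar (τ ∷ b ∷ interleave (opposite τ) w)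
    ≡⟨ bar-∷ τ (b ∷ interleave (opposite τ) w) ⟩
  bar (b ∷ interleave (opposite τ) w) ++ (opposite τ ∷ [])
    ≡⟨ cong (_++ (opposite τ ∷ [])) (bar-∷ b (interleave (opposite τ) w)) ⟩
  (bar (interleave (opposite τ) w) ++ (opposite b ∷ [])) ++ (opposite τ ∷ [])
    ≡⟨ List.++-assoc (bar (interleave (opposite τ) w)) _ _ ⟩
  bar (interleave (opposite τ) w) ++ (opposite b ∷ opposite τ ∷ [])
    ≡⟨ cong (_++ (opposite b ∷ opposite τ ∷ [])) (bar-interleave (opposite τ) w) ⟩
  interleave ρ (bar w) ++ (opposite b ∷ opposite τ ∷ [])
    ≡⟨ List.++-assoc (interleave₀ ρ (bar w)) _ _ ⟩
  interleave₀ ρ (bar w) ++ (opp^ (length (bar w)) ρ ∷ opposite b ∷ opposite τ ∷ [])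
    ≡⟨ cong (λ z → interleave₀ ρ (bar w) ++ (opp^ (length (bar w)) ρ ∷ opposite b ∷ z ∷ [])) (sym last) ⟩
  interleave₀ ρ (bar w) ++ interleave (opp^ (length (bar w)) ρ) (opposite b ∷ [])
    ≡⟨ interleave-++ ρ (bar w) (opposite b ∷ []) ⟨
  interleave ρ (bar w ++ (opposite b ∷ []))
    ≡⟨ cong (interleave ρ) (bar-∷ b w) ⟨
  interleave ρ (bar (b ∷ w)) ∎
  where
    open ≡-Reasoning
    ρ = opposite (opp^ (length w) (opposite τ))
    last : opposite (opp^ (length (bar w)) ρ) ≡ opposite τ
    last = cong opposite (begin
      opp^ (length (bar w)) ρ                           ≡⟨ cong (λ n → opp^ n ρ) (bar-length w) ⟩
      opp^ (length w) ρ                                 ≡⟨ opp^-opposite (length w) _ ⟩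
      opposite (opp^ (length w) (opp^ (length w) (opposite τ))) ≡⟨ cong opposite (opp^-involutive (length w) (opposite τ)) ⟩
      opposite (opposite τ)                             ≡⟨ Sign.opposite-involutive τ ⟩
      τ                                                 ∎)

interleave-folding : ∀ {n T} → IsFolding n T → ∀ σ → IsFolding (suc n) (interleave σ T)
interleave-folding fold-zero σ = fold-suc fold-zero σ
interleave-folding {suc n} (fold-suc {n} {U} d s) σ =
  subst (IsFolding (suc (suc n))) (sym unfold) (fold-suc (interleave-folding d σ'') s)
  where
    open ≡-Reasoning
    σ'' = opposite (opp^ (length U) σ)
    start : opposite (opp^ (length U) σ'') ≡ σ
    start = trans (cong opposite (trans (opp^-opposite (length U) _)
                                        (cong opposite (opp^-involutive (length U) σ))))
                  (Sign.opposite-involutive σ)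
    unfold : interleave σ (bar U ++ (s ∷ U)) ≡ bar (interleave σ'' U) ++ (s ∷ interleave σ'' U)
    unfold = begin
      interleave σ (bar U ++ (s ∷ U))
        ≡⟨ interleave-++ σ (bar U) (s ∷ U) ⟩
      interleave₀ σ (bar U) ++ (opp^ (length (bar U)) σ ∷ s ∷ interleave (opposite (opp^ (length (bar U)) σ)) U)
        ≡⟨ List.++-assoc (interleave₀ σ (bar U)) (opp^ (length (bar U)) σ ∷ []) _ ⟨
      interleave σ (bar U) ++ (s ∷ interleave (opposite (opp^ (length (bar U)) σ)) U)
        ≡⟨ cong (λ m → interleave σ (bar U) ++ (s ∷ interleave (opposite (opp^ m σ)) U)) (bar-length U) ⟩
      interleave σ (bar U) ++ (s ∷ interleave σ'' U)
        ≡⟨ cong (λ z → interleave z (bar U) ++ (s ∷ interleave σ'' U)) start ⟨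
      interleave (opposite (opp^ (length U) σ'')) (bar U) ++ (s ∷ interleave σ'' U)
        ≡⟨ cong (_++ (s ∷ interleave σ'' U)) (bar-interleave σ'' U) ⟨
      bar (interleave σ'' U) ++ (s ∷ interleave σ'' U) ∎

-- Fold instructions t : ℕ → Sign and the canonical complete folding sequence
-- canon t:  canon t (2k+1) = t₀·(-1)^k  and  canon t (2k) = canon (tail t) k.
-- (canon t 0 = + by convention.)  It is computed by recursion on a fuel
-- argument; any fuel ≥ ∣x∣ gives the same value.

tail : (ℕ → Sign) → ℕ → Sign
tail t j = t (suc j)

canon-step : ((ℕ → Sign) → ℤ → Sign) → (ℕ → Sign) → ℤ × Bool → Sign
canon-step rec t (k , true)  = t 0 · alt k
canon-step rec t (k , false) = rec (tail t) k

canonᶠ : ℕ → (ℕ → Sign) → ℤ → Sign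
canonᶠ zero    t x = Sign.+
canonᶠ (suc f) t x = canon-step (canonᶠ f) t (halve x)

canonᶠ-stable : ∀ f f' t x → ∣ x ∣ ≤ f → ∣ x ∣ ≤ f' → canonᶠ f t x ≡ canonᶠ f' t x
canonᶠ-stable zero    zero     t x _ _ = refl
canonᶠ-stable zero    (suc f') t (+ 0) _ _ = canonᶠ-stable zero f' (tail t) (+ 0) z≤n z≤n
canonᶠ-stable (suc f) zero     t (+ 0) _ _ = canonᶠ-stable f zero (tail t) (+ 0) z≤n z≤n
canonᶠ-stable (suc f) (suc f') t x l l' = go (halve x) (halve-spec x)
  where
    halves : ∀ {g} k → x ≡ k + k + + 0 → ∣ x ∣ ≤ suc g → ∣ k ∣ ≤ g
    halves {g} k e le = half-le ∣ k ∣ (subst (_≤ suc g) (trans (cong ∣_∣ (trans e (ℤ.+-identityʳ (k + k)))) (∣double∣ k)) le)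
      where
        half-le : ∀ n → n ℕ.+ n ≤ suc g → n ≤ g
        half-le zero    _         = z≤n
        half-le (suc n) (s≤s le)  = ℕ.≤-trans (ℕ.m≤n+m (suc n) n) le
    go : ∀ p → x ≡ unhalve p → canon-step (canonᶠ f) t p ≡ canon-step (canonᶠ f') t p
    go (k , true)  e = refl
    go (k , false) e = canonᶠ-stable f f' (tail t) k (halves k e l) (halves k e l')

canon : (ℕ → Sign) → Seq
canon t x = canonᶠ (suc ∣ x ∣) t x

canon-odd : ∀ t k → canon t (k + k + + 1) ≡ t 0 · alt k
canon-odd t k = cong (canon-step _ t) (halve-odd k)

canon-even : ∀ t k → canon t (k + k) ≡ canon (tail t) k
canon-even t k = trans (cong (canon-step _ t) (halve-even k))
  (canonᶠ-stable _ _ (tail t) k (subst (∣ k ∣ ≤_) (sym (∣double∣ k)) (ℕ.m≤m+n _ _)) (ℕ.n≤1+n _))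

canon-odd-shift : ∀ t k n → canon t (k + k + + 1 + + (n ℕ.+ n)) ≡ t 0 · alt (k + + n)
canon-odd-shift t k n = trans (cong (canon t) (trans (cong (λ z → k + k + + 1 + z) (ℤ.pos-+ n n)) (l k (+ n))))
                              (canon-odd t (k + + n))
  where l : ∀ k m → k + k + + 1 + (m + m) ≡ (k + m) + (k + m) + + 1
        l = solve-∀

canon-even-shift : ∀ t k n → canon t (k + k + + (n ℕ.+ n)) ≡ canon (tail t) (k + + n)
canon-even-shift t k n = trans (cong (canon t) (trans (cong (λ z → k + k + z) (ℤ.pos-+ n n)) (l k (+ n))))
                               (canon-even t (k + + n))
  where l : ∀ k m → k + k + (m + m) ≡ (k + m) + (k + m)
        l = solve-∀

canon-odd-flips : ∀ t k → canon t (k + k + + 1 + + 2) ≡ opposite (canon t (k + k + + 1))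
canon-odd-flips t k = begin
  canon t (k + k + + 1 + + (1 ℕ.+ 1)) ≡⟨ canon-odd-shift t k 1 ⟩
  t 0 · alt (k + + 1)                 ≡⟨ cong (t 0 ·_) (alt-suc k) ⟩
  t 0 · opposite (alt k)              ≡⟨ ·-opposite (t 0) (alt k) ⟩
  opposite (t 0 · alt k)              ≡⟨ cong opposite (canon-odd t k) ⟨
  opposite (canon t (k + k + + 1))    ∎
  where open ≡-Reasoning

-- A window of canon t starting at an odd place is an
-- interleaving of a window of canon (tail t) half as long; by induction on
-- the length every window is a subword of some folding sequence.

window-canon-odd : ∀ t j M → window (canon t) (j + j + + 1) (suc (M ℕ.+ M)) ≡
                             interleave (t 0 · alt j) (window (canon (tail t)) (j + + 1) M)
window-canon-odd t j zero    = cong (_∷ []) (canon-odd t j)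
window-canon-odd t j (suc M) rewrite ℕ.+-suc M M =
  cong₂ _∷_ (canon-odd t j)
    (cong₂ _∷_ (trans (cong (canon t) (next-even j)) (canon-even t (j + + 1)))
      (trans (cong (λ z → window (canon t) (z + + 1) (suc (M ℕ.+ M))) (next-even j))
        (trans (window-canon-odd t (j + + 1) M)
          (cong (λ s → interleave s (window (canon (tail t)) (j + + 1 + + 1) M))
                (trans (cong (t 0 ·_) (alt-suc j)) (·-opposite (t 0) (alt j)))))))
  where next-even : ∀ j → j + j + + 1 + + 1 ≡ (j + + 1) + (j + + 1)
        next-even = solve-∀

FoldingSubword : Word → Set
FoldingSubword u = Σ ℕ λ n → Σ Word λ S → IsFolding n S × SubwordFin u S

halves-cover : ∀ n → n ≤ ⌈ n /2⌉ ℕ.+ ⌈ n /2⌉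
halves-cover n = subst (_≤ ⌈ n /2⌉ ℕ.+ ⌈ n /2⌉) (ℕ.⌊n/2⌋+⌈n/2⌉≡n n) (ℕ.+-monoˡ-≤ ⌈ n /2⌉ (ℕ.⌊n/2⌋≤⌈n/2⌉ n))

windows-canon-folding : ∀ L t h → FoldingSubword (window (canon t) h L)
windows-canon-folding = <-rec (λ L → ∀ t h → FoldingSubword (window (canon t) h L)) step
  where
    step : ∀ L → (∀ {M} → M < L → ∀ t h → FoldingSubword (window (canon t) h M)) →
           ∀ t h → FoldingSubword (window (canon t) h L)
    step zero          ih t h = 0 , [] , fold-zero , subword-refl []
    step (suc zero)    ih t h = 1 , (canon t h ∷ []) , fold-suc fold-zero (canon t h) , subword-refl _
    step L@(suc (suc _)) ih t h = start (parity h)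
      where
        -- the window lies at offset ≤ 1 in the odd-started window of length 2⌈L/2⌉+1
        from-odd : ∀ j off → j + j + + 1 + + off ≡ h → off ≤ 1 → FoldingSubword (window (canon t) h L)
        from-odd j off e off≤1
          with ℕ.m≤n⇒∃[o]m+o≡n (ℕ.+-mono-≤ off≤1 (halves-cover L))
        ... | r , er with ih (ℕ.⌈n/2⌉<n _) (tail t) (j + + 1)
        ... | n , T , folding , sub with interleave-subword sub (t 0 · alt j)
        ... | σ' , sub' = suc n , interleave σ' T , interleave-folding folding σ' ,
          subword-trans
            (subst (SubwordFin (window (canon t) h L))
                   (trans (cong (window (canon t) (j + j + + 1)) (trans (sym (ℕ.+-assoc off L r)) er))
                          (window-canon-odd t j ⌈ L /2⌉))
                   (window-subword (canon t) (j + j + + 1) off L r h e))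
            sub'
        start : Parity h → FoldingSubword (window (canon t) h L)
        start (even k) = from-odd (k - + 1) 1 (l k) (s≤s z≤n)
          where l : ∀ k → (k - + 1) + (k - + 1) + + 1 + + 1 ≡ k + k
                l = solve-∀
        start (odd k)  = from-odd k 0 (ℤ.+-identityʳ _) z≤n

canon-complete : ∀ t → IsCompleteFolding (canon t)
canon-complete t u (h , e) = subst FoldingSubword e (windows-canon-folding (length u) t h)

-- Parity is visible locally.  On the odd places canon t alternates with
-- step 2; on the even places it is canon (tail t), which cannot alternate on
-- four consecutive places.  So the pattern Alt4 marks exactly the odd places.

Odd : ℤ → Set
Odd x = Σ ℤ λ k → x ≡ k + k + + 1

Alt4 : Seq → ℤ → Set
Alt4 a x = (a (x + + 2) ≡ opposite (a (x + + 0)))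
         × (a (x + + 4) ≡ opposite (a (x + + 2)))
         × (a (x + + 6) ≡ opposite (a (x + + 4)))

Alt4-transport : ∀ {a b x y} → Agree a b x y 7 → Alt4 a x → Alt4 b y
Alt4-transport {a} {b} {x} {y} ag (p , q , r) = move 0 2 p , move 2 4 q , move 4 6 r
  where
    move : ∀ i j {_ : T (i <ᵇ 7)} {_ : T (j <ᵇ 7)} → a (x + + j) ≡ opposite (a (x + + i)) →
           b (y + + j) ≡ opposite (b (y + + i))
    move i j {i<7} {j<7} e =
      trans (sym (at ag j (ℕ.<ᵇ⇒< j 7 j<7))) (trans e (cong opposite (at ag i (ℕ.<ᵇ⇒< i 7 i<7))))

no-double-flip : ∀ {a b c : Sign} → b ≡ opposite a → c ≡ opposite b → c ≡ opposite a → ⊥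
no-double-flip {a} e₁ e₂ e₃ = Sign.s≢opposite[s] a
  (trans (sym (Sign.opposite-involutive a)) (trans (cong opposite (sym e₁)) (trans (sym e₂) e₃)))

odd⇒Alt4 : ∀ t {x} → Odd x → Alt4 (canon t) x
odd⇒Alt4 t (k , refl) = flips 0 , flips 1 , flips 2
  where
    flips : ∀ n → canon t (k + k + + 1 + + (suc n ℕ.+ suc n)) ≡ opposite (canon t (k + k + + 1 + + (n ℕ.+ n)))
    flips n = begin
      canon t (k + k + + 1 + + (suc n ℕ.+ suc n)) ≡⟨ canon-odd-shift t k (suc n) ⟩
      t 0 · alt (k + + suc n)                     ≡⟨ cong (λ z → t 0 · alt z) (+1+ k n) ⟨
      t 0 · alt (k + + 1 + + n)                   ≡⟨ cong (λ z → t 0 · alt z) (l k (+ n)) ⟩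
      t 0 · alt (k + + n + + 1)                   ≡⟨ cong (t 0 ·_) (alt-suc (k + + n)) ⟩
      t 0 · opposite (alt (k + + n))              ≡⟨ ·-opposite (t 0) _ ⟩
      opposite (t 0 · alt (k + + n))              ≡⟨ cong opposite (canon-odd-shift t k n) ⟨
      opposite (canon t (k + k + + 1 + + (n ℕ.+ n))) ∎
      where
        open ≡-Reasoning
        l : ∀ k n → k + + 1 + n ≡ k + n + + 1
        l = solve-∀

-- canon t does not alternate on four consecutive places: whichever of
-- k, k+1 is odd, alternation would contradict the step-2 flip there.
no-four-alternation : ∀ t k → canon t (k + + 1) ≡ opposite (canon t (k + + 0)) →
  canon t (k + + 2) ≡ opposite (canon t (k + + 1)) → canon t (k + + 3) ≡ opposite (canon t (k + + 2)) → ⊥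
no-four-alternation t k p q r with parity k
... | odd j  = no-double-flip p q
  (trans (canon-odd-flips t j) (cong (λ z → opposite (canon t z)) (sym (ℤ.+-identityʳ (j + j + + 1)))))
... | even j = no-double-flip q r (trans (cong (canon t) (l j)) (canon-odd-flips t j))
  where l : ∀ j → j + j + + 3 ≡ j + j + + 1 + + 2
        l = solve-∀

even⇒¬Alt4 : ∀ t k → ¬ Alt4 (canon t) (k + k)
even⇒¬Alt4 t k (p , q , r) = no-four-alternation (tail t) k (along 0 p) (along 1 q) (along 2 r)
  where
    along : ∀ n → canon t (k + k + + (suc n ℕ.+ suc n)) ≡ opposite (canon t (k + k + + (n ℕ.+ n))) →
            canon (tail t) (k + + suc n) ≡ opposite (canon (tail t) (k + + n))
    along n e = trans (sym (canon-even-shift t k (suc n))) (trans e (cong opposite (canon-even-shift t k n)))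

Alt4⇒odd : ∀ t x → Alt4 (canon t) x → Odd x
Alt4⇒odd t x alt4 with parity x
... | even k = ⊥-elim (even⇒¬Alt4 t k alt4)
... | odd k  = k , refl

data SameParity : ℤ → ℤ → Set where
  evens : ∀ k k' → SameParity (k + k) (k' + k')
  odds  : ∀ k k' → SameParity (k + k + + 1) (k' + k' + + 1)

agree-parity : ∀ {t t' x y} → Agree (canon t) (canon t') x y 7 → SameParity x y
agree-parity {t} {t'} {x} {y} ag with parity x | parity y
... | even k | even k' = evens k k'
... | odd k  | odd k'  = odds k k'
... | even k | odd k'  = ⊥-elim (even⇒¬Alt4 t k (Alt4-transport (Agree-sym ag) (odd⇒Alt4 t' (k' , refl))))
... | odd k  | even k' = ⊥-elim (even⇒¬Alt4 t' k' (Alt4-transport ag (odd⇒Alt4 t (k , refl))))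

same-parity-alt : ∀ {x y} → SameParity x y → alt x ≡ alt y
same-parity-alt (evens k k') = trans (alt-double k) (sym (alt-double k'))
same-parity-alt (odds k k')  = trans (alt-odd k) (sym (alt-odd k'))

agree-tails : ∀ {s s' k k'} M → Agree (canon s) (canon s') (k + k) (k' + k') (M ℕ.+ M) →
              Agree (canon (tail s)) (canon (tail s')) k k' M
agree-tails {s} {s'} {k} {k'} M ag = agree λ i i<M →
  trans (sym (canon-even-shift s k i))
        (trans (at ag (i ℕ.+ i) (ℕ.+-mono-< i<M i<M)) (canon-even-shift s' k' i))

agree-halves : ∀ {s s' x y} M → 3 ≤ M → Agree (canon s) (canon s') x y (suc (M ℕ.+ M)) →
  Σ ℤ λ k → Σ ℤ λ k' → Agree (canon s) (canon s') (k + k) (k' + k') (M ℕ.+ M)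
                     × Agree (canon (tail s)) (canon (tail s')) k k' M
agree-halves M 3≤M ag with agree-parity (Agree-≤ (s≤s (ℕ.+-mono-≤ 3≤M 3≤M)) ag)
... | evens k k' = k , k' , ag' , agree-tails M ag'
  where ag' = Agree-≤ (ℕ.n≤1+n _) ag
... | odds k k'  = k + + 1 , k' + + 1 , ag' , agree-tails M ag'
  where
    next : ∀ k → k + k + + 1 + + 1 ≡ (k + + 1) + (k + + 1)
    next = solve-∀
    ag' = subst₂ (λ u v → Agree _ _ u v (M ℕ.+ M)) (next k) (next k') (Agree-drop (M ℕ.+ M) 1 ag)

-- Rigidity: a long enough agreement between canon s and canon s' forces
-- s j ≡ s' j.  Each halving step costs a factor 2 in length.

rigidity-length : ℕ → ℕ
rigidity-length zero    = 15
rigidity-length (suc j) = suc (rigidity-length j ℕ.+ rigidity-length j)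

3≤rigidity-length : ∀ j → 3 ≤ rigidity-length j
3≤rigidity-length zero    = ℕ.≤ᵇ⇒≤ 3 15 _
3≤rigidity-length (suc j) = ℕ.≤-trans (3≤rigidity-length j) (ℕ.≤-trans (ℕ.m≤m+n _ _) (ℕ.n≤1+n _))

rigidity : ∀ j {s s' x y} → Agree (canon s) (canon s') x y (rigidity-length j) → s j ≡ s' j
rigidity zero {s} {s'} ag with agree-halves 7 (ℕ.≤ᵇ⇒≤ 3 7 _) ag
... | k , k' , ag₁ , ag₂ = Sign.*-cancelʳ-≡ (alt k) (s 0) (s' 0) (begin
  s 0 · alt k               ≡⟨ canon-odd s k ⟨
  canon s (k + k + + 1)     ≡⟨ at ag₁ 1 (ℕ.<ᵇ⇒< 1 14 _) ⟩
  canon s' (k' + k' + + 1)  ≡⟨ canon-odd s' k' ⟩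
  s' 0 · alt k'             ≡⟨ cong (s' 0 ·_) (same-parity-alt (agree-parity ag₂)) ⟨
  s' 0 · alt k              ∎)
  where open ≡-Reasoning
rigidity (suc j) ag with agree-halves (rigidity-length j) (3≤rigidity-length j) ag
... | k , k' , _ , ag₂ = rigidity j ag₂

-- Part (1): distinct fold instructions give canonical sequences that are not
-- locally isomorphic, since a window of canon s occurring in canon s' forces
-- agreement of the instructions.

toSign : Bool → Sign
toSign true  = Sign.+
toSign false = Sign.-

toSign-injective : ∀ a b → toSign a ≡ toSign b → a ≡ b
toSign-injective true  true  _ = refl
toSign-injective false false _ = refl

canonical-family : Cantor → Seq
canonical-family α = canon (λ n → toSign (α n))

canonical-family-distinct : ∀ α β → LocallyIsomorphic (canonical-family α) (canonical-family β) → α ≈c β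
canonical-family-distinct α β li n =
  toSign-injective _ _ (rigidity n (proj₂ (window-transfer li (+ 0) (rigidity-length n))))

-- Every n-folding sequence occurs in a canonical sequence, at the places
-- -(2ⁿ-1), …, -1.  The reason is the reflection symmetry of canon t about
-- -2ⁿ, which mirrors the recursive shape bar U ++ s ∷ U of a folding sequence.

data ParityN : ℕ → Set where
  evenN : ∀ m → ParityN (m ℕ.+ m)
  oddN  : ∀ m → ParityN (suc (m ℕ.+ m))

parityN : ∀ n → ParityN n
parityN zero = evenN 0
parityN (suc n) with parityN n
... | evenN m = oddN m
... | oddN m  = subst ParityN (cong suc (ℕ.+-suc m m)) (evenN (suc m))

half-< : ∀ m p → m ℕ.+ m < p ℕ.+ p → m < p
half-< m p lt = ℕ.*-cancelˡ-< 2 m p (subst₂ _<_ (twice m) (twice p) lt)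
  where twice : ∀ n → n ℕ.+ n ≡ 2 ℕ.* n
        twice n = cong (n ℕ.+_) (sym (ℕ.+-identityʳ n))

2^suc : ∀ n → + (2 ^ suc n) ≡ + (2 ^ n) + + (2 ^ n)
2^suc n = cong +_ (cong (2 ^ n ℕ.+_) (ℕ.+-identityʳ (2 ^ n)))

·≡-⇒opposite : ∀ s t → s · t ≡ Sign.- → s ≡ opposite t
·≡-⇒opposite s t e = Sign.*-cancelʳ-≡ t s (opposite t) (trans e (sym (Sign.opposite[s]*s≡- t)))

-- For even k both sides pass to canon (tail t) about -2ⁿ⁻¹; for odd k both
-- are odd places, whose alternation signs differ.
canon-reflection : ∀ n t k → 1 ≤ k → k < 2 ^ n →
                   canon t (- + (2 ^ n) - + k) ≡ opposite (canon t (- + (2 ^ n) + + k))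
canon-reflection zero    t k (s≤s _) (s≤s ())
canon-reflection (suc n) t k 1≤k k<2ⁿ⁺¹ rewrite 2^suc n = by-parity (parityN k) 1≤k k<2ⁿ⁺¹
  where
    P = + (2 ^ n)
    by-parity : ∀ {k} → ParityN k → 1 ≤ k → k < 2 ^ n ℕ.+ (2 ^ n ℕ.+ 0) →
                canon t (- (P + P) - + k) ≡ opposite (canon t (- (P + P) + + k))
    by-parity (evenN m) 1≤k k<2ⁿ⁺¹ = begin
      canon t (- (P + P) - + (m ℕ.+ m))  ≡⟨ cong (canon t) (l₁ P (+ m)) ⟩
      canon t ((- P - + m) + (- P - + m)) ≡⟨ canon-even t (- P - + m) ⟩
      canon (tail t) (- P - + m)          ≡⟨ canon-reflection n (tail t) m 1≤m m<2ⁿ ⟩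
      opposite (canon (tail t) (- P + + m))        ≡⟨ cong opposite (canon-even t (- P + + m)) ⟨
      opposite (canon t ((- P + + m) + (- P + + m))) ≡⟨ cong (λ z → opposite (canon t z)) (l₂ P (+ m)) ⟨
      opposite (canon t (- (P + P) + + (m ℕ.+ m))) ∎
      where
        open ≡-Reasoning
        l₁ : ∀ P m → - (P + P) - (m + m) ≡ (- P - m) + (- P - m)
        l₁ = solve-∀
        l₂ : ∀ P m → - (P + P) + (m + m) ≡ (- P + m) + (- P + m)
        l₂ = solve-∀
        positive-half : ∀ m → 1 ≤ m ℕ.+ m → 1 ≤ m
        positive-half (suc m) _ = s≤s z≤n
        1≤m : 1 ≤ m
        1≤m = positive-half m 1≤k
        m<2ⁿ : m < 2 ^ n
        m<2ⁿ = half-< m (2 ^ n) (subst (m ℕ.+ m <_) (cong (2 ^ n ℕ.+_) (ℕ.+-identityʳ _)) k<2ⁿ⁺¹)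
    by-parity (oddN m) _ _ = begin
      canon t (- (P + P) - + suc (m ℕ.+ m))  ≡⟨ cong (canon t) (l₁ P (+ m)) ⟩
      canon t (y + y + + 1)                  ≡⟨ canon-odd t y ⟩
      t 0 · alt y                            ≡⟨ cong (t 0 ·_) opposite-parity ⟩
      t 0 · opposite (alt (- P + + m))       ≡⟨ ·-opposite (t 0) _ ⟩
      opposite (t 0 · alt (- P + + m))       ≡⟨ cong opposite (canon-odd t (- P + + m)) ⟨
      opposite (canon t ((- P + + m) + (- P + + m) + + 1)) ≡⟨ cong (λ z → opposite (canon t z)) (l₂ P (+ m)) ⟨
      opposite (canon t (- (P + P) + + suc (m ℕ.+ m))) ∎
      where
        open ≡-Reasoning
        y = - P - + m - + 1
        l₁ : ∀ P m → - (P + P) - (+ 1 + (m + m)) ≡ (- P - m - + 1) + (- P - m - + 1) + + 1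
        l₁ = solve-∀
        l₂ : ∀ P m → - (P + P) + (+ 1 + (m + m)) ≡ (- P + m) + (- P + m) + + 1
        l₂ = solve-∀
        l₃ : ∀ P m → (- P - m - + 1) + (- P + m) ≡ (- P - + 1) + (- P - + 1) + + 1
        l₃ = solve-∀
        opposite-parity : alt y ≡ opposite (alt (- P + + m))
        opposite-parity = ·≡-⇒opposite _ _
          (trans (sym (alt-+ y (- P + + m))) (trans (cong alt (l₃ P (+ m))) (alt-odd (- P - + 1))))

canon-at-−2ⁿ : ∀ n t → canon t (- + (2 ^ n)) ≡ opposite (t n)
canon-at-−2ⁿ zero    t =
  trans (canon-odd t (- + 1)) (trans (·-opposite (t 0) Sign.+) (cong opposite (Sign.*-identityʳ (t 0))))
canon-at-−2ⁿ (suc n) t rewrite 2^suc n =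
  trans (cong (canon t) (l (+ (2 ^ n)))) (trans (canon-even t (- + (2 ^ n))) (canon-at-−2ⁿ n (tail t)))
  where l : ∀ P → - (P + P) ≡ (- P) + (- P)
        l = solve-∀

window-reflected : ∀ a b x y L → (∀ i → i < L → a (x + + i) ≡ opposite (b (y + + (L ∸ suc i)))) →
                   window a x L ≡ bar (window b y L)
window-reflected a b x y zero    h = refl
window-reflected a b x y (suc L) h = begin
  a x ∷ window a (x + + 1) L
    ≡⟨ cong₂ _∷_ (trans (cong a (sym (ℤ.+-identityʳ x))) (h 0 (s≤s z≤n)))
                 (window-reflected a b (x + + 1) y L (λ i i<L → trans (cong a (+1+ x i)) (h (suc i) (s≤s i<L)))) ⟩
  opposite (b (y + + L)) ∷ bar (window b y L)
    ≡⟨ bar-++ (window b y L) (b (y + + L) ∷ []) ⟨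
  bar (window b y L ++ (b (y + + L) ∷ []))
    ≡⟨ cong bar (window-++ b y L 1) ⟨
  bar (window b y (L ℕ.+ 1))
    ≡⟨ cong (λ n → bar (window b y n)) (ℕ.+-comm L 1) ⟩
  bar (window b y (suc L)) ∎
  where open ≡-Reasoning

-- The fold sign used at level j in a derivation of an n-folding sequence
-- (+ for j ≥ n).
fold-sign : ∀ {n T} → IsFolding n T → ℕ → Sign
fold-sign fold-zero            j = Sign.+
fold-sign (fold-suc {n} d s) j = if j ≡ᵇ n then s else fold-sign d j

≡ᵇ-< : ∀ j n → j < n → (j ≡ᵇ n) ≡ false
≡ᵇ-< zero    (suc n) _         = refl
≡ᵇ-< (suc j) (suc n) (s≤s j<n) = ≡ᵇ-< j n j<n

≡ᵇ-refl : ∀ n → (n ≡ᵇ n) ≡ true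
≡ᵇ-refl zero    = refl
≡ᵇ-refl (suc n) = ≡ᵇ-refl n

folding-length : ∀ {n T} → IsFolding n T → suc (length T) ≡ 2 ^ n
folding-length fold-zero = refl
folding-length {suc n} (fold-suc {n} {U} d s) = begin
  suc (length (bar U ++ (s ∷ U)))       ≡⟨ cong suc (List.length-++ (bar U)) ⟩
  suc (length (bar U) ℕ.+ suc (length U)) ≡⟨ cong (λ m → suc (m ℕ.+ suc (length U))) (bar-length U) ⟩
  suc (length U) ℕ.+ suc (length U)      ≡⟨ cong (λ z → z ℕ.+ z) (folding-length d) ⟩
  2 ^ n ℕ.+ 2 ^ n                        ≡⟨ cong (2 ^ n ℕ.+_) (ℕ.+-identityʳ _) ⟨
  2 ^ suc n                              ∎
  where open ≡-Reasoning

-- The reflection about -2ⁿ, in the coordinates used for folding sequences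
-- of length u = 2ⁿ - 1 placed at -(2u+1), …, -1.
canon-mirror : ∀ n t i r → suc (suc i ℕ.+ r) ≡ 2 ^ n →
  canon t (- + ((suc i ℕ.+ r) ℕ.+ suc (suc i ℕ.+ r)) + + i) ≡
  opposite (canon t (- + (suc i ℕ.+ r) + + ((suc i ℕ.+ r) ∸ suc i)))
canon-mirror n t i r 2ⁿ = begin
  canon t (- + ((suc i ℕ.+ r) ℕ.+ suc (suc i ℕ.+ r)) + + i) ≡⟨ cong (canon t) (l₁ (+ i) (+ r)) ⟩
  canon t (- + (suc (suc i ℕ.+ r)) - + suc r)               ≡⟨ cong (λ m → canon t (- + m - + suc r)) 2ⁿ ⟩
  canon t (- + (2 ^ n) - + suc r)                           ≡⟨ canon-reflection n t (suc r) (s≤s z≤n) r<2ⁿ ⟩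
  opposite (canon t (- + (2 ^ n) + + suc r))                ≡⟨ cong (λ m → opposite (canon t (- + m + + suc r))) 2ⁿ ⟨
  opposite (canon t (- + (suc (suc i ℕ.+ r)) + + suc r))    ≡⟨ cong (λ z → opposite (canon t z)) (l₂ (+ i) (+ r)) ⟨
  opposite (canon t (- + (suc i ℕ.+ r) + + r))              ≡⟨ cong (λ m → opposite (canon t (- + (suc i ℕ.+ r) + + m))) (ℕ.m+n∸m≡n (suc i) r) ⟨
  opposite (canon t (- + (suc i ℕ.+ r) + + ((suc i ℕ.+ r) ∸ suc i))) ∎
  where
    open ≡-Reasoning
    l₁ : ∀ I R → - ((+ 1 + (I + R)) + (+ 1 + (+ 1 + (I + R)))) + I ≡ - (+ 1 + (+ 1 + (I + R))) - (+ 1 + R)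
    l₁ = solve-∀
    l₂ : ∀ I R → - (+ 1 + (I + R)) + R ≡ - (+ 1 + (+ 1 + (I + R))) + (+ 1 + R)
    l₂ = solve-∀
    r<2ⁿ : suc r < 2 ^ n
    r<2ⁿ = subst (suc r <_) 2ⁿ (s≤s (s≤s (ℕ.m≤n+m r i)))

folding-in-canon : ∀ {n T} (d : IsFolding n T) t → (∀ j → j < n → t j ≡ opposite (fold-sign d j)) →
                   T ≡ window (canon t) (- + length T) (length T)
folding-in-canon fold-zero t h = refl
folding-in-canon {suc n} (fold-suc {n} {U} d s) t h =
  trans unfold (cong (λ m → window (canon t) (- + m) m) (sym length-T))
  where
    u = length U
    length-T : length (bar U ++ (s ∷ U)) ≡ u ℕ.+ suc u
    length-T = trans (List.length-++ (bar U)) (cong (ℕ._+ suc u) (bar-length U))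
    Y = - + (u ℕ.+ suc u)
    2ⁿ : suc u ≡ 2 ^ n
    2ⁿ = folding-length d
    right : U ≡ window (canon t) (- + u) u
    right = folding-in-canon d t (λ j j<n → trans (h j (ℕ.≤-trans j<n (ℕ.n≤1+n n)))
              (cong (λ b → opposite (if b then s else fold-sign d j)) (≡ᵇ-< j n j<n)))
    middle : canon t (Y + + u) ≡ s
    middle = begin
      canon t (Y + + u)          ≡⟨ cong (canon t) (l (+ u)) ⟩
      canon t (- + suc u)        ≡⟨ cong (λ m → canon t (- + m)) 2ⁿ ⟩
      canon t (- + (2 ^ n))      ≡⟨ canon-at-−2ⁿ n t ⟩
      opposite (t n)             ≡⟨ cong opposite (h n (ℕ.n<1+n n)) ⟩
      opposite (opposite (if n ≡ᵇ n then s else fold-sign d n)) ≡⟨ Sign.opposite-involutive _ ⟩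
      (if n ≡ᵇ n then s else fold-sign d n) ≡⟨ cong (if_then s else fold-sign d n) (≡ᵇ-refl n) ⟩
      s ∎
      where
        open ≡-Reasoning
        l : ∀ U → - (U + (+ 1 + U)) + U ≡ - (+ 1 + U)
        l = solve-∀
    mirrored : ∀ i → i < u → canon t (Y + + i) ≡ opposite (canon t (- + u + + (u ∸ suc i)))
    mirrored i i<u with ℕ.m≤n⇒∃[o]m+o≡n i<u
    ... | r , e rewrite sym e = canon-mirror n t i r (trans (cong suc e) 2ⁿ)
    left : window (canon t) Y u ≡ bar U
    left = trans (window-reflected (canon t) (canon t) Y (- + u) u mirrored) (cong bar (sym right))
    unfold : bar U ++ (s ∷ U) ≡ window (canon t) Y (u ℕ.+ suc u)
    unfold = sym (trans (window-++ (canon t) Y u (suc u)) (cong₂ _++_ left (cong₂ _∷_ middle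
      (trans (cong (λ z → window (canon t) z u) (l (+ u))) (sym right)))))
      where l : ∀ U → - (U + (+ 1 + U)) + U + + 1 ≡ - U
            l = solve-∀

window-prefix : ∀ a h L u q → window a h L ≡ u ++ q → window a h (length u) ≡ u
window-prefix a h L       []      q e = refl
window-prefix a h (suc L) (x ∷ u) q e =
  cong₂ _∷_ (List.∷-injectiveˡ e) (window-prefix a (h + + 1) L u q (List.∷-injectiveʳ e))

subword-of-window : ∀ a h L {u} → SubwordFin u (window a h L) → Subword u a
subword-of-window a h L {u} (p , q , e) = go h L p e
  where
    go : ∀ h L p → window a h L ≡ p ++ (u ++ q) → Subword u a
    go h L       []      e = h , window-prefix a h L u q e
    go h (suc L) (x ∷ p) e = go (h + + 1) L p (List.∷-injectiveʳ e)

LocallyCanonical : Seq → Set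
LocallyCanonical S = ∀ x L → Σ (ℕ → Sign) λ t → Σ ℤ λ y → Agree S (canon t) x y L

complete⇒locally-canonical : ∀ S → IsCompleteFolding S → LocallyCanonical S
complete⇒locally-canonical S complete x L
  with complete (window S x L) (x , cong (window S x) (window-length S x L))
... | n , T , d , sub with subword-of-window (canon t) _ _ (subst (SubwordFin (window S x L)) (folding-in-canon d t (λ _ _ → refl)) sub)
  where t : ℕ → Sign
        t j = opposite (fold-sign d j)
... | y , e = _ , y , agree-window S (canon _) x y L
                 (sym (trans (cong (window (canon _) y) (sym (window-length S x L))) e))

-- The Alt4 pattern, which in
-- canon t marks the odd places, is seen through windows of S; so S has a
-- parity class c + 2ℤ on which it alternates, S (c + 2m) = σ·(-1)^m, and the
-- complementary class again carries a locally canonical sequence.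

module LocallyCanonicalStructure (S : Seq) (lc : LocallyCanonical S) where

  Alt4-shift : ∀ x → Alt4 S x → Alt4 S (x + + 2)
  Alt4-shift x alt4 with lc x 9
  ... | t , y , ag with Alt4⇒odd t y (Alt4-transport (Agree-≤ (ℕ.≤ᵇ⇒≤ 7 9 _) ag) alt4)
  ... | k , refl = Alt4-transport (Agree-sym (Agree-drop 7 2 ag)) (odd⇒Alt4 t (k + + 1 , l k))
    where l : ∀ k → k + k + + 1 + + 2 ≡ (k + + 1) + (k + + 1) + + 1
          l = solve-∀

  Alt4-unshift : ∀ x → Alt4 S x → Alt4 S (x - + 2)
  Alt4-unshift x alt4 with lc (x - + 2) 9
  ... | t , y , ag with Alt4⇒odd t (y + + 2) (Alt4-transport (Agree-drop 7 2 ag) (subst (Alt4 S) (sym (l x)) alt4))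
    where l : ∀ x → x - + 2 + + 2 ≡ x
          l = solve-∀
  ... | k , e = Alt4-transport (Agree-sym (Agree-≤ (ℕ.≤ᵇ⇒≤ 7 9 _) ag)) (odd⇒Alt4 t (k - + 1 , l k y e))
    where l : ∀ k y → y + + 2 ≡ k + k + + 1 → y ≡ (k - + 1) + (k - + 1) + + 1
          l k y e = trans (sym (m y)) (trans (cong (_- + 2) e) (n k))
            where m : ∀ y → y + + 2 - + 2 ≡ y
                  m = solve-∀
                  n : ∀ k → k + k + + 1 - + 2 ≡ (k - + 1) + (k - + 1) + + 1
                  n = solve-∀

  -- The window at 0 occurs in some canon t at y; whichever of y, y+1 is odd
  -- gives an Alt4 place of S.
  alt-class-start : Σ ℤ λ c → Alt4 S c
  alt-class-start with lc (+ 0) 8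
  ... | t , y , ag with parity y
  ... | odd k  = + 0 , Alt4-transport (Agree-sym (Agree-≤ (ℕ.≤ᵇ⇒≤ 7 8 _) ag)) (odd⇒Alt4 t (k , refl))
  ... | even k = + 1 , Alt4-transport (Agree-sym (Agree-drop 7 1 ag)) (odd⇒Alt4 t (k , refl))

  c : ℤ
  c = proj₁ alt-class-start

  Alt4-class : ∀ m → Alt4 S (c + (m + m))
  Alt4-class = ℤ-ind (λ m → Alt4 S (c + (m + m)))
    (subst (Alt4 S) (sym (ℤ.+-identityʳ c)) (proj₂ alt-class-start))
    (λ m alt4 → subst (Alt4 S) (l₁ c m) (Alt4-shift (c + (m + m)) alt4))
    (λ m alt4 → subst (Alt4 S) (l₂ c m) (Alt4-unshift (c + (m + m)) alt4))
    where
      l₁ : ∀ c m → c + (m + m) + + 2 ≡ c + ((m + + 1) + (m + + 1))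
      l₁ = solve-∀
      l₂ : ∀ c m → c + (m + m) - + 2 ≡ c + ((m - + 1) + (m - + 1))
      l₂ = solve-∀

  σ : Sign
  σ = S (c + (+ 0 + + 0))

  alternating-class : ∀ m → S (c + (m + m)) ≡ σ · alt m
  alternating-class = flips⇒alt (λ m → S (c + (m + m))) λ m →
    trans (cong S (l c m)) (trans (proj₁ (Alt4-class m)) (cong (λ z → opposite (S z)) (ℤ.+-identityʳ _)))
    where l : ∀ c m → c + ((m + + 1) + (m + + 1)) ≡ c + (m + m) + + 2
          l = solve-∀

  rest : Seq
  rest m = S (c + (m + m) + + 1)

  -- A window of `rest` spreads over a window of S of double length, which
  -- sits in some canon t at an odd place (it starts on the alternating class);
  -- the even places of that window then read canon (tail t).
  rest-locally-canonical : LocallyCanonical rest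
  rest-locally-canonical x L with lc (c + (x + x)) (7 ℕ.+ (L ℕ.+ L))
  ... | t , y , ag = from-odd (Alt4⇒odd t y (Alt4-transport (Agree-≤ (ℕ.m≤m+n 7 (L ℕ.+ L)) ag) (Alt4-class x))) ag
    where
      l₁ : ∀ c x i → c + ((x + i) + (x + i)) + + 1 ≡ c + (x + x) + (+ 1 + (i + i))
      l₁ = solve-∀
      l₂ : ∀ k i → k + k + + 1 + (+ 1 + (i + i)) ≡ (k + + 1 + i) + (k + + 1 + i)
      l₂ = solve-∀
      bound : ∀ i → i < L → suc (i ℕ.+ i) < 7 ℕ.+ (L ℕ.+ L)
      bound i i<L = ℕ.≤-trans (s≤s (s≤s (ℕ.+-mono-≤ (ℕ.<⇒≤ i<L) (ℕ.<⇒≤ i<L))))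
                              (ℕ.+-monoˡ-≤ (L ℕ.+ L) (ℕ.≤ᵇ⇒≤ 2 7 _))
      from-odd : ∀ {y} → Odd y → Agree S (canon t) (c + (x + x)) y (7 ℕ.+ (L ℕ.+ L)) →
                 Σ (ℕ → Sign) λ t' → Σ ℤ λ y' → Agree rest (canon t') x y' L
      from-odd (k , refl) ag = tail t , k + + 1 , agree λ i i<L →
        trans (cong S (l₁ c x (+ i)))
          (trans (at ag (suc (i ℕ.+ i)) (bound i i<L))
            (trans (cong (canon t) (l₂ k (+ i))) (canon-even t (k + + 1 + + i))))

record Decomposition (X : Seq) : Set where
  field
    offset      : ℕ → ℤ
    sign        : ℕ → Sign
    level       : ℕ → Seq
    level-zero  : ∀ x → level 0 x ≡ X x
    level-even  : ∀ j m → level j (offset j + (m + m)) ≡ sign j · alt m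
    level-odd   : ∀ j m → level (suc j) m ≡ level j (offset j + (m + m) + + 1)

-- The only data of a decomposition that matters up to local isomorphism.
invariant : ∀ {X} → Decomposition X → ℕ → Sign
invariant D j = Decomposition.sign D j · alt (Decomposition.offset D (suc j))

decompose : ∀ S → LocallyCanonical S → Decomposition S
decompose S lc = record
  { offset     = λ j → LocallyCanonicalStructure.c (levels j .proj₁) (levels j .proj₂)
  ; sign       = λ j → LocallyCanonicalStructure.σ (levels j .proj₁) (levels j .proj₂)
  ; level      = λ j → levels j .proj₁
  ; level-zero = λ x → refl
  ; level-even = λ j → LocallyCanonicalStructure.alternating-class (levels j .proj₁) (levels j .proj₂)
  ; level-odd  = λ j m → refl
  }
  where
    levels : ℕ → Σ Seq LocallyCanonical
    levels zero    = S , lc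
    levels (suc j) = let open LocallyCanonicalStructure (levels j .proj₁) (levels j .proj₂)
                     in rest , rest-locally-canonical

sign-reached : ∀ ρ v → Σ ℤ λ p → ρ · alt p ≡ v
sign-reached Sign.+ Sign.+ = + 0 , refl
sign-reached Sign.+ Sign.- = + 1 , refl
sign-reached Sign.- Sign.- = + 0 , refl
sign-reached Sign.- Sign.+ = + 1 , refl

-- Every window at level k is matched, by induction on its
-- length, at the same parity of place: its odd places form a window of
-- half the length at level k+1, and its even places alternate with a sign
-- fixed by the invariant.

module SameInvariant {X Y : Seq} (C : Decomposition X) (D : Decomposition Y)
                     (same : ∀ j → invariant C j ≡ invariant D j) where
  open Decomposition C
  open Decomposition D renaming (offset to d; sign to ρ; level to Ys; level-zero to Ys-zero;
                                  level-even to Ys-even; level-odd to Ys-odd)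

  Matched : ℕ → Set
  Matched L = ∀ k z → Σ ℤ λ z' → (alt z' ≡ alt z) × Agree (level k) (Ys k) (offset k + z) (d k + z') L

  even-signs : ∀ k n z'' → alt z'' ≡ alt (n - offset (suc k)) →
               sign k · alt n ≡ ρ k · alt (d (suc k) + z'')
  even-signs k n z'' e = begin
    sign k · alt n                                     ≡⟨ cong (sign k ·_) (·-cancel-self a (alt n)) ⟨
    sign k · (a · (a · alt n))                         ≡⟨ Sign.*-assoc (sign k) a _ ⟨
    invariant C k · (a · alt n)                        ≡⟨ cong (_· (a · alt n)) (same k) ⟩
    (ρ k · b) · (a · alt n)                            ≡⟨ Sign.*-assoc (ρ k) b _ ⟩
    ρ k · (b · (a · alt n))                            ≡⟨ cong (λ s → ρ k · (b · s)) (Sign.*-comm a (alt n)) ⟩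
    ρ k · (b · (alt n · a))                            ≡⟨ cong (λ s → ρ k · (b · s)) (alt-- n (offset (suc k))) ⟨
    ρ k · (b · alt (n - offset (suc k)))               ≡⟨ cong (λ s → ρ k · (b · s)) e ⟨
    ρ k · (b · alt z'')                                ≡⟨ cong (ρ k ·_) (alt-+ (d (suc k)) z'') ⟨
    ρ k · alt (d (suc k) + z'')                        ∎
    where
      open ≡-Reasoning
      a = alt (offset (suc k))
      b = alt (d (suc k))

  matched-1 : Matched 1
  matched-1 k z with parity z
  ... | even n with sign-reached (ρ k) (level k (offset k + (n + n)))
  ...   | p , e = p + p , trans (alt-double p) (sym (alt-double n)) ,
                  Agree-single (trans (sym e) (sym (Ys-even k p)))
  matched-1 k z | odd n with sign-reached (ρ (suc k)) (level k (offset k + (n + n + + 1)))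
  ...   | p , e = n' + n' + + 1 , trans (alt-odd n') (sym (alt-odd n)) ,
                  Agree-single (trans (sym e) (trans (sym (Ys-even (suc k) p))
                    (trans (Ys-odd k n') (cong (Ys k) (ℤ.+-assoc (d k) (n' + n') (+ 1))))))
    where n' = d (suc k) + (p + p)

  matched-double : ∀ M k n → Matched M →
                   Σ ℤ λ n' → Agree (level k) (Ys k) (offset k + (n + n)) (d k + (n' + n')) (suc (M ℕ.+ M))
  matched-double M k n ih with ih (suc k) (n - offset (suc k))
  ... | z'' , e , ag = n' , agree λ j j<2M+1 → place (parityN j) j<2M+1
    where
      n' = d (suc k) + z''
      l₁ : ∀ c n i → c + (n + n) + (i + i) ≡ c + ((n + i) + (n + i))
      l₁ = solve-∀
      l₂ : ∀ c n i → c + (n + n) + (+ 1 + (i + i)) ≡ c + ((n + i) + (n + i)) + + 1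
      l₂ = solve-∀
      l₃ : ∀ c n i → c + (n - c) + i ≡ n + i
      l₃ = solve-∀
      place : ∀ {j} → ParityN j → j < suc (M ℕ.+ M) →
              level k (offset k + (n + n) + + j) ≡ Ys k (d k + (n' + n') + + j)
      place (evenN i) _ = begin
        level k (offset k + (n + n) + + (i ℕ.+ i))   ≡⟨ cong (level k) (l₁ (offset k) n (+ i)) ⟩
        level k (offset k + ((n + + i) + (n + + i))) ≡⟨ level-even k (n + + i) ⟩
        sign k · alt (n + + i)                       ≡⟨ cong (sign k ·_) (alt-+ n (+ i)) ⟩
        sign k · (alt n · alt (+ i))                 ≡⟨ Sign.*-assoc (sign k) _ _ ⟨
        (sign k · alt n) · alt (+ i)                 ≡⟨ cong (_· alt (+ i)) (even-signs k n z'' e) ⟩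
        (ρ k · alt n') · alt (+ i)                   ≡⟨ Sign.*-assoc (ρ k) _ _ ⟩
        ρ k · (alt n' · alt (+ i))                   ≡⟨ cong (ρ k ·_) (alt-+ n' (+ i)) ⟨
        ρ k · alt (n' + + i)                         ≡⟨ Ys-even k (n' + + i) ⟨
        Ys k (d k + ((n' + + i) + (n' + + i)))       ≡⟨ cong (Ys k) (l₁ (d k) n' (+ i)) ⟨
        Ys k (d k + (n' + n') + + (i ℕ.+ i))         ∎
        where open ≡-Reasoning
      place (oddN i) (s≤s j<2M) = begin
        level k (offset k + (n + n) + + suc (i ℕ.+ i))       ≡⟨ cong (level k) (l₂ (offset k) n (+ i)) ⟩
        level k (offset k + ((n + + i) + (n + + i)) + + 1)   ≡⟨ level-odd k (n + + i) ⟨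
        level (suc k) (n + + i)                               ≡⟨ cong (level (suc k)) (l₃ (offset (suc k)) n (+ i)) ⟨
        level (suc k) (offset (suc k) + (n - offset (suc k)) + + i) ≡⟨ at ag i (half-< i M j<2M) ⟩
        Ys (suc k) (n' + + i)                                 ≡⟨ Ys-odd k (n' + + i) ⟩
        Ys k (d k + ((n' + + i) + (n' + + i)) + + 1)          ≡⟨ cong (Ys k) (l₂ (d k) n' (+ i)) ⟨
        Ys k (d k + (n' + n') + + suc (i ℕ.+ i))              ∎
        where open ≡-Reasoning

  matched : ∀ L → Matched L
  matched = <-rec Matched step
    where
      step : ∀ L → (∀ {M} → M < L → Matched M) → Matched L
      step zero          ih k z = z , refl , agree λ i ()
      step (suc zero)    ih     = matched-1
      step L@(suc (suc _)) ih k z with parity z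
      ... | even n with matched-double M k n (ih (ℕ.⌈n/2⌉<n _))
        where M = ⌈ L /2⌉
      ...   | n' , ag = n' + n' , trans (alt-double n') (sym (alt-double n)) ,
                        Agree-≤ (ℕ.≤-trans (halves-cover L) (ℕ.n≤1+n _)) ag
      step L@(suc (suc _)) ih k z | odd n with matched-double M k n (ih (ℕ.⌈n/2⌉<n _))
        where M = ⌈ L /2⌉
      ...   | n' , ag = n' + n' + + 1 , trans (alt-odd n') (sym (alt-odd n)) ,
        subst₂ (λ u v → Agree (level k) (Ys k) u v L)
               (ℤ.+-assoc (offset k) (n + n) (+ 1)) (ℤ.+-assoc (d k) (n' + n') (+ 1))
               (Agree-drop L 1 (Agree-≤ (s≤s (halves-cover L)) ag))

  subwords : ∀ u → Subword u X → Subword u Y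
  subwords u (h , e) with matched (length u) 0 (h - offset 0)
  ... | z' , _ , ag = d 0 + z' , trans (window-agree (length u) (agree λ i i<L →
      trans (sym (Ys-zero _)) (trans (sym (at ag i i<L))
        (trans (cong (level 0) (l (offset 0) h (+ i))) (level-zero _))))) e
    where l : ∀ c h i → c + (h - c) + i ≡ h + i
          l = solve-∀

same-invariant⇒locally-isomorphic : ∀ {X Y} (C : Decomposition X) (D : Decomposition Y) →
  (∀ j → invariant C j ≡ invariant D j) → LocallyIsomorphic X Y
same-invariant⇒locally-isomorphic C D same u =
  mk⇔ (SameInvariant.subwords C D same u) (SameInvariant.subwords D C (λ j → sym (same j)) u)

-- Given offsets b j ∈ {0,1} and signs ρ j, there is a sequence
-- with a decomposition having exactly these offsets and signs, provided b
-- never repeats a value three times in a row: level j at x is ρ j·(-1)^m if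
-- x - b j = 2m, and level (j+1) at m if x - b j = 2m+1.  The recursion can
-- stall only at x = -1 (while b = 0) or x = -2 (while b = 1), which the
-- hypothesis rules out.

NoRun3 : (ℕ → Bool) → Set
NoRun3 b = ∀ j → ¬ ((b j ≡ b (suc j)) × (b (suc j) ≡ b (suc (suc j))))

module Realise (b : ℕ → Bool) (no-run : NoRun3 b) (ρ : ℕ → Sign) where

  d : ℕ → ℤ
  d j = bit (b j)

  gen-step : (ℕ → ℤ → Sign) → ℕ → ℤ × Bool → Sign
  gen-step rec j (m , false) = ρ j · alt m
  gen-step rec j (m , true)  = rec (suc j) m

  gen : ℕ → ℕ → ℤ → Sign
  gen zero    j x = Sign.+
  gen (suc f) j x = gen-step (gen f) j (halve (x - d j))

  data Term : ℕ → ℕ → ℤ → Set where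
    stop : ∀ {f j x} m → halve (x - d j) ≡ (m , false) → Term (suc f) j x
    next : ∀ {f j x} m → halve (x - d j) ≡ (m , true) → Term f (suc j) m → Term (suc f) j x

  Term-mono : ∀ {f f' j x} → f ≤ f' → Term f j x → Term f' j x
  Term-mono (s≤s le) (stop m e)   = stop m e
  Term-mono (s≤s le) (next m e t) = next m e (Term-mono le t)

  gen-det : ∀ {f f' j x} → Term f j x → Term f' j x → gen f j x ≡ gen f' j x
  gen-det {suc f} {suc f'} {j} (stop m e) _ =
    trans (cong (gen-step (gen f) j) e) (sym (cong (gen-step (gen f') j) e))
  gen-det {suc f} {suc f'} {j} (next m e t) (stop m' e') with trans (sym e) e'
  ... | ()
  gen-det {suc f} {suc f'} {j} (next m e t) (next m' e' t') with trans (sym e) e'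
  ... | refl = trans (cong (gen-step (gen f) j) e) (trans (gen-det t t') (sym (cong (gen-step (gen f') j) e)))

  stop-at : ∀ {f j x} v m → b j ≡ v → x - bit v ≡ m + m → Term (suc f) j x
  stop-at {j = j} {x} v m e eq =
    stop m (trans (cong (λ w → halve (x - bit w)) e) (trans (cong halve eq) (halve-even m)))

  next-at : ∀ {f j x} v m → b j ≡ v → x - bit v ≡ m + m + + 1 → Term f (suc j) m → Term (suc f) j x
  next-at {j = j} {x} v m e eq t =
    next m (trans (cong (λ w → halve (x - bit w)) e) (trans (cong halve eq) (halve-odd m))) t

  no-run-contra : ∀ {j v} → b j ≡ v → b (suc j) ≡ v → b (suc (suc j)) ≡ v → ⊥
  no-run-contra e₀ e₁ e₂ = no-run _ (trans e₀ (sym e₁) , trans e₁ (sym e₂))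

  Term-−1 : ∀ j → Term 3 j -[1+ 0 ]
  Term-−1 j with b j in e₀ | b (suc j) in e₁ | b (suc (suc j)) in e₂
  ... | true  | _     | _     = stop-at true -[1+ 0 ] e₀ refl
  ... | false | true  | _     = next-at false -[1+ 0 ] e₀ refl (stop-at true -[1+ 0 ] e₁ refl)
  ... | false | false | true  = next-at false -[1+ 0 ] e₀ refl (next-at false -[1+ 0 ] e₁ refl
                                  (stop-at true -[1+ 0 ] e₂ refl))
  ... | false | false | false = ⊥-elim (no-run-contra e₀ e₁ e₂)

  Term-−2 : ∀ j → Term 3 j -[1+ 1 ]
  Term-−2 j with b j in e₀ | b (suc j) in e₁ | b (suc (suc j)) in e₂
  ... | false | _     | _     = stop-at false -[1+ 0 ] e₀ refl
  ... | true  | false | _     = next-at true -[1+ 1 ] e₀ refl (stop-at false -[1+ 0 ] e₁ refl)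
  ... | true  | true  | false = next-at true -[1+ 1 ] e₀ refl (next-at true -[1+ 1 ] e₁ refl
                                  (stop-at false -[1+ 0 ] e₂ refl))
  ... | true  | true  | true  = ⊥-elim (no-run-contra e₀ e₁ e₂)

  Term-0 : ∀ j → Term 4 j (+ 0)
  Term-0 j with b j in e
  ... | false = stop-at false (+ 0) e refl
  ... | true  = next-at true -[1+ 0 ] e refl (Term-−1 (suc j))

  Term-1 : ∀ j → Term 5 j (+ 1)
  Term-1 j with b j in e
  ... | true  = stop-at true (+ 0) e refl
  ... | false = next-at false (+ 0) e refl (Term-0 (suc j))

  Term-2 : ∀ j → Term 5 j (+ 2)
  Term-2 j with b j in e
  ... | false = stop-at false (+ 1) e refl
  ... | true  = next-at true (+ 0) e refl (Term-0 (suc j))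

  ∣d+1∣≤2 : ∀ j → ∣ d j + + 1 ∣ ≤ 2
  ∣d+1∣≤2 j with b j
  ... | true  = s≤s (s≤s z≤n)
  ... | false = s≤s z≤n

  Term-large : ∀ x j → 3 ≤ ∣ x ∣ → (∀ m → ∣ m ∣ < ∣ x ∣ → Term (6 ℕ.+ ∣ m ∣) (suc j) m) →
               Term (6 ℕ.+ ∣ x ∣) j x
  Term-large x j 3≤∣x∣ ih = by-halving (halve (x - d j)) refl (halve-spec (x - d j))
    where
      by-halving : ∀ p → halve (x - d j) ≡ p → x - d j ≡ unhalve p → Term (6 ℕ.+ ∣ x ∣) j x
      by-halving (m , false) e _  = stop m e
      by-halving (m , true)  e eq = next m e (Term-mono (ℕ.+-monoʳ-≤ 5 ∣m∣<∣x∣) (ih m ∣m∣<∣x∣))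
        where
          double-m : m + m ≡ x - (d j + + 1)
          double-m = trans (sym (l₁ m)) (trans (cong (_- + 1) (sym eq)) (l₂ x (d j)))
            where l₁ : ∀ m → m + m + + 1 - + 1 ≡ m + m
                  l₁ = solve-∀
                  l₂ : ∀ x d → x - d - + 1 ≡ x - (d + + 1)
                  l₂ = solve-∀
          ∣m∣<∣x∣ : ∣ m ∣ < ∣ x ∣
          ∣m∣<∣x∣ = halving-< ∣ m ∣ ∣ x ∣ 2 (subst (_≤ ∣ x ∣ ℕ.+ 2) (∣double∣ m)
            (subst (λ z → ∣ z ∣ ≤ ∣ x ∣ ℕ.+ 2) (sym double-m)
              (ℕ.≤-trans (ℤ.∣i-j∣≤∣i∣+∣j∣ x (d j + + 1)) (ℕ.+-monoʳ-≤ ∣ x ∣ (∣d+1∣≤2 j))))) 3≤∣x∣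

  terminates : ∀ x j → Term (6 ℕ.+ ∣ x ∣) j x
  terminates x = <-rec (λ n → ∀ x → ∣ x ∣ ≡ n → ∀ j → Term (6 ℕ.+ ∣ x ∣) j x) step ∣ x ∣ x refl
    where
      step : ∀ n → (∀ {n'} → n' < n → ∀ x → ∣ x ∣ ≡ n' → ∀ j → Term (6 ℕ.+ ∣ x ∣) j x) →
             ∀ x → ∣ x ∣ ≡ n → ∀ j → Term (6 ℕ.+ ∣ x ∣) j x
      step n ih (+ 0)         _ j = Term-mono (ℕ.≤ᵇ⇒≤ 4 6 _) (Term-0 j)
      step n ih (+ 1)         _ j = Term-mono (ℕ.≤ᵇ⇒≤ 5 7 _) (Term-1 j)
      step n ih (+ 2)         _ j = Term-mono (ℕ.≤ᵇ⇒≤ 5 8 _) (Term-2 j)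
      step n ih -[1+ 0 ]      _ j = Term-mono (ℕ.≤ᵇ⇒≤ 3 7 _) (Term-−1 j)
      step n ih -[1+ 1 ]      _ j = Term-mono (ℕ.≤ᵇ⇒≤ 3 8 _) (Term-−2 j)
      step n ih x@(+ suc (suc (suc _)))  refl j =
        Term-large x j (s≤s (s≤s (s≤s z≤n))) (λ m lt → ih lt m refl (suc j))
      step n ih x@(-[1+ suc (suc _) ]) refl j =
        Term-large x j (s≤s (s≤s (s≤s z≤n))) (λ m lt → ih lt m refl (suc j))

  level : ℕ → Seq
  level j x = gen (6 ℕ.+ ∣ x ∣) j x

  level-even : ∀ j m → level j (d j + (m + m)) ≡ ρ j · alt m
  level-even j m = cong (gen-step (gen (5 ℕ.+ ∣ d j + (m + m) ∣)) j) (trans (cong halve (l (d j) m)) (halve-even m))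
    where l : ∀ d m → d + (m + m) - d ≡ m + m
          l = solve-∀

  level-odd : ∀ j m → level (suc j) m ≡ level j (d j + (m + m) + + 1)
  level-odd j m = trans (cong (gen-step (gen (6 ℕ.+ ∣ m ∣)) j) (sym halved))
                        (gen-det (next m halved (terminates m (suc j))) (terminates x j))
    where
      x = d j + (m + m) + + 1
      l : ∀ d m → d + (m + m) + + 1 - d ≡ m + m + + 1
      l = solve-∀
      halved : halve (x - d j) ≡ (m , true)
      halved = trans (cong halve (l (d j) m)) (halve-odd m)

  realisation : Decomposition (level 0)
  realisation = record
    { offset = d ; sign = ρ ; level = level ; level-zero = λ x → refl
    ; level-even = level-even ; level-odd = level-odd }

-- The alternating class of each
-- level is determined by the level itself, so a shift between two
-- decomposed sequences descends level by level, halving at each step.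

module _ {X : Seq} (C : Decomposition X) where
  open Decomposition C

  -- No level flips at every step: level j takes the values σ, -σ at
  -- offset j and offset j + 2.
  level-not-flipping : ∀ j → ¬ Flips (level j)
  level-not-flipping j flips = no-double-flip (flips x₀) (flips (x₀ + + 1))
    (trans (cong (level j) (l (offset j))) (trans (level-even j (+ 1))
      (trans (·-opposite (sign j) Sign.+) (cong opposite (sym (level-even j (+ 0)))))))
    where
      x₀ = offset j + (+ 0 + + 0)
      l : ∀ c → c + (+ 0 + + 0) + + 1 + + 1 ≡ c + (+ 1 + + 1)
      l = solve-∀

  alternating-class-unique : ∀ j e → (∀ m → level j (e + (m + m) + + 2) ≡ opposite (level j (e + (m + m)))) →
                             Σ ℤ λ q → e - offset j ≡ q + q
  alternating-class-unique j e alternates = by-parity (parity (e - offset j)) refl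
    where
      by-parity : ∀ {w} → Parity w → w ≡ e - offset j → Σ ℤ λ q → e - offset j ≡ q + q
      by-parity (even q) w = q , sym w
      by-parity (odd q)  w = ⊥-elim (level-not-flipping (suc j) flips)
        where
          odd-place : ∀ p → offset j + (p + p) + + 1 ≡ e + ((p - q) + (p - q))
          odd-place p = trans (l₁ (offset j) p q)
            (cong (_+ ((p - q) + (p - q))) (trans (cong (λ z → offset j + z) w) (l₂ (offset j) e)))
            where l₁ : ∀ c p q → c + (p + p) + + 1 ≡ (c + (q + q + + 1)) + ((p - q) + (p - q))
                  l₁ = solve-∀
                  l₂ : ∀ c e → c + (e - c) ≡ e
                  l₂ = solve-∀
          l₃ : ∀ e q p → e + ((p - q) + (p - q)) + + 2 ≡ e + (((p + + 1) - q) + ((p + + 1) - q))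
          l₃ = solve-∀
          flips : Flips (level (suc j))
          flips p = begin
            level (suc j) (p + + 1)                           ≡⟨ level-odd j (p + + 1) ⟩
            level j (offset j + ((p + + 1) + (p + + 1)) + + 1) ≡⟨ cong (level j) (odd-place (p + + 1)) ⟩
            level j (e + (((p + + 1) - q) + ((p + + 1) - q))) ≡⟨ cong (level j) (l₃ e q p) ⟨
            level j (e + ((p - q) + (p - q)) + + 2)           ≡⟨ alternates (p - q) ⟩
            opposite (level j (e + ((p - q) + (p - q))))      ≡⟨ cong (λ z → opposite (level j z)) (odd-place p) ⟨
            opposite (level j (offset j + (p + p) + + 1))     ≡⟨ cong opposite (level-odd j p) ⟨
            opposite (level (suc j) p)                        ∎
            where open ≡-Reasoning

module Shift {X Y : Seq} (C : Decomposition X) (D : Decomposition Y) where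
  open Decomposition C
  open Decomposition D renaming (offset to d; sign to ρ; level to Ys; level-zero to Ys-zero;
                                  level-even to Ys-even; level-odd to Ys-odd)

  Shifted : ℕ → ℤ → Set
  Shifted j κ = ∀ h → Ys j h ≡ level j (h + κ)

  shift-step : ∀ j κ → Shifted j κ → Σ ℤ λ κ' → (d j + κ - offset j ≡ κ' + κ') × Shifted (suc j) κ'
  shift-step j κ shifted with alternating-class-unique C j (d j + κ) alternates
    where
      l₁ : ∀ d κ m → d + (m + m) + + 2 + κ ≡ d + κ + (m + m) + + 2
      l₁ = solve-∀
      l₂ : ∀ d κ m → d + (m + m) + κ ≡ d + κ + (m + m)
      l₂ = solve-∀
      l₃ : ∀ d m → d + (m + m) + + 2 ≡ d + ((m + + 1) + (m + + 1))
      l₃ = solve-∀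
      alternates : ∀ m → level j (d j + κ + (m + m) + + 2) ≡ opposite (level j (d j + κ + (m + m)))
      alternates m = begin
        level j (d j + κ + (m + m) + + 2)     ≡⟨ cong (level j) (l₁ (d j) κ m) ⟨
        level j (d j + (m + m) + + 2 + κ)     ≡⟨ shifted _ ⟨
        Ys j (d j + (m + m) + + 2)            ≡⟨ cong (Ys j) (l₃ (d j) m) ⟩
        Ys j (d j + ((m + + 1) + (m + + 1)))  ≡⟨ Ys-even j (m + + 1) ⟩
        ρ j · alt (m + + 1)                   ≡⟨ cong (ρ j ·_) (alt-suc m) ⟩
        ρ j · opposite (alt m)                ≡⟨ ·-opposite (ρ j) (alt m) ⟩
        opposite (ρ j · alt m)                ≡⟨ cong opposite (Ys-even j m) ⟨
        opposite (Ys j (d j + (m + m)))       ≡⟨ cong opposite (trans (shifted _) (cong (level j) (l₂ (d j) κ m))) ⟩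
        opposite (level j (d j + κ + (m + m))) ∎
        where open ≡-Reasoning
  ... | κ' , e = κ' , e , λ h → begin
    Ys (suc j) h                            ≡⟨ Ys-odd j h ⟩
    Ys j (d j + (h + h) + + 1)              ≡⟨ shifted _ ⟩
    level j (d j + (h + h) + + 1 + κ)       ≡⟨ cong (level j) (l (d j) κ (offset j) κ' h e) ⟩
    level j (offset j + ((h + κ') + (h + κ')) + + 1) ≡⟨ level-odd j (h + κ') ⟨
    level (suc j) (h + κ')                  ∎
    where
      open ≡-Reasoning
      l : ∀ d κ c κ' h → d + κ - c ≡ κ' + κ' → d + (h + h) + + 1 + κ ≡ c + ((h + κ') + (h + κ')) + + 1
      l d κ c κ' h e = trans (l₁ d κ c h) (trans (cong (λ z → c + z + (h + h) + + 1) e) (l₂ c κ' h))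
        where l₁ : ∀ d κ c h → d + (h + h) + + 1 + κ ≡ c + (d + κ - c) + (h + h) + + 1
              l₁ = solve-∀
              l₂ : ∀ c κ' h → c + (κ' + κ') + (h + h) + + 1 ≡ c + ((h + κ') + (h + κ')) + + 1
              l₂ = solve-∀

  module Descent (κ₀ : ℤ) (shifted₀ : ∀ h → Y h ≡ X (h + κ₀)) where
    shifts : (j : ℕ) → Σ ℤ (Shifted j)
    shifts zero    = κ₀ , λ h → trans (Ys-zero h) (trans (shifted₀ h) (sym (level-zero _)))
    shifts (suc j) = let (κ' , _ , s) = shift-step j (proj₁ (shifts j)) (proj₂ (shifts j)) in κ' , s

    κ : ℕ → ℤ
    κ j = proj₁ (shifts j)

    κ-step : ∀ j → d j + κ j - offset j ≡ κ (suc j) + κ (suc j)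
    κ-step j = proj₁ (proj₂ (shift-step j (κ j) (proj₂ (shifts j))))

-- The shift
-- roughly halves, so it becomes 0 or ±1; at ±1 it survives a step only for
-- one value of u j, so (u having no run of three) it reaches 0, after which
-- it stays 0 and forces u j = v j.

module ShiftDynamics (u v : ℕ → Bool) (no-run : NoRun3 u) (κ : ℕ → ℤ)
                     (κ-step : ∀ j → bit (v j) + κ j - bit (u j) ≡ κ (suc j) + κ (suc j)) where

  ∣step∣ : ∀ b b' k → ∣ bit b' + k - bit b ∣ ≤ ∣ k ∣ ℕ.+ 1
  ∣step∣ false false k = subst (λ z → ∣ z ∣ ≤ ∣ k ∣ ℕ.+ 1) (sym (l k)) (ℕ.m≤m+n _ 1)
    where l : ∀ k → + 0 + k - + 0 ≡ k
          l = solve-∀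
  ∣step∣ true  true  k = subst (λ z → ∣ z ∣ ≤ ∣ k ∣ ℕ.+ 1) (sym (l k)) (ℕ.m≤m+n _ 1)
    where l : ∀ k → + 1 + k - + 1 ≡ k
          l = solve-∀
  ∣step∣ false true  k = subst (λ z → ∣ z ∣ ≤ ∣ k ∣ ℕ.+ 1) (sym (l k)) (ℤ.∣i+j∣≤∣i∣+∣j∣ k (+ 1))
    where l : ∀ k → + 1 + k - + 0 ≡ k + + 1
          l = solve-∀
  ∣step∣ true  false k = subst (λ z → ∣ z ∣ ≤ ∣ k ∣ ℕ.+ 1) (sym (l k)) (ℤ.∣i-j∣≤∣i∣+∣j∣ k (+ 1))
    where l : ∀ k → + 0 + k - + 1 ≡ k - + 1
          l = solve-∀

  κ-halves : ∀ j → ∣ κ (suc j) ∣ ℕ.+ ∣ κ (suc j) ∣ ≤ ∣ κ j ∣ ℕ.+ 1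
  κ-halves j = subst (_≤ ∣ κ j ∣ ℕ.+ 1) (∣double∣ (κ (suc j)))
                 (subst (λ z → ∣ z ∣ ≤ ∣ κ j ∣ ℕ.+ 1) (κ-step j) (∣step∣ (u j) (v j) (κ j)))

  κ-next : ∀ n j → ∣ κ j ∣ ≤ suc (suc n) → ∣ κ (suc j) ∣ ≤ suc n
  κ-next n j le with ∣ κ j ∣ ℕ.≤? 1
  ... | yes small = ℕ.≤-trans (ℕ.≤-pred (halving-< _ 2 0 (ℕ.≤-trans (κ-halves j) (ℕ.+-monoˡ-≤ 1 small)) (s≤s z≤n))) (s≤s z≤n)
  ... | no  big   = ℕ.≤-pred (ℕ.<-≤-trans (halving-< _ _ 1 (κ-halves j) (ℕ.≰⇒> big)) le)

  κ-becomes-small : ∀ n j → ∣ κ j ∣ ≤ suc n → ∣ κ (n ℕ.+ j) ∣ ≤ 1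
  κ-becomes-small zero    j le = le
  κ-becomes-small (suc n) j le =
    subst (λ i → ∣ κ i ∣ ≤ 1) (ℕ.+-suc n j) (κ-becomes-small n (suc j) (κ-next n j le))

  from-0 : ∀ b b' k' → bit b' + + 0 - bit b ≡ k' + k' → (k' ≡ + 0) × (b ≡ b')
  from-0 false false k' e = double-injective k' (+ 0) (sym e) , refl
  from-0 true  true  k' e = double-injective k' (+ 0) (sym e) , refl
  from-0 false true  k' e = ⊥-elim (even≢odd k' (+ 0) (sym e))
  from-0 true  false k' e = ⊥-elim (even≢odd k' -[1+ 0 ] (sym e))

  from-1 : ∀ b b' k' → bit b' + + 1 - bit b ≡ k' + k' → (k' ≡ + 0) ⊎ ((k' ≡ + 1) × (b ≡ false))
  from-1 false false k' e = ⊥-elim (even≢odd k' (+ 0) (sym e))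
  from-1 true  true  k' e = ⊥-elim (even≢odd k' (+ 0) (sym e))
  from-1 false true  k' e = inj₂ (double-injective k' (+ 1) (sym e) , refl)
  from-1 true  false k' e = inj₁ (double-injective k' (+ 0) (sym e))

  from-−1 : ∀ b b' k' → bit b' + -[1+ 0 ] - bit b ≡ k' + k' → (k' ≡ + 0) ⊎ ((k' ≡ -[1+ 0 ]) × (b ≡ true))
  from-−1 false false k' e = ⊥-elim (even≢odd k' -[1+ 0 ] (sym e))
  from-−1 true  true  k' e = ⊥-elim (even≢odd k' -[1+ 0 ] (sym e))
  from-−1 false true  k' e = inj₁ (double-injective k' (+ 0) (sym e))
  from-−1 true  false k' e = inj₂ (double-injective k' -[1+ 0 ] (sym e) , refl)

  κ-step-at : ∀ j s → κ j ≡ s → bit (v j) + s - bit (u j) ≡ κ (suc j) + κ (suc j)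
  κ-step-at j s e = trans (cong (λ z → bit (v j) + z - bit (u j)) (sym e)) (κ-step j)

  escape : ∀ s b → (∀ j → κ j ≡ s → (κ (suc j) ≡ + 0) ⊎ ((κ (suc j) ≡ s) × (u j ≡ b))) →
           ∀ j → κ j ≡ s → Σ ℕ λ n → κ (n ℕ.+ j) ≡ + 0
  escape s b persists j e with persists j e
  ... | inj₁ z = 1 , z
  ... | inj₂ (e₁ , u₀) with persists (suc j) e₁
  ...   | inj₁ z = 2 , z
  ...   | inj₂ (e₂ , u₁) with persists (suc (suc j)) e₂
  ...     | inj₁ z = 3 , z
  ...     | inj₂ (_ , u₂) = ⊥-elim (no-run j (trans u₀ (sym u₁) , trans u₁ (sym u₂)))

  κ-reaches-zero : ∀ j → ∣ κ j ∣ ≤ 1 → Σ ℕ λ n → κ (n ℕ.+ j) ≡ + 0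
  κ-reaches-zero j le with κ j in e
  ... | + 0      = 0 , e
  ... | + 1      = escape (+ 1) false (λ i eᵢ → from-1 (u i) (v i) _ (κ-step-at i (+ 1) eᵢ)) j e
  ... | -[1+ 0 ] = escape -[1+ 0 ] true (λ i eᵢ → from-−1 (u i) (v i) _ (κ-step-at i -[1+ 0 ] eᵢ)) j e
  κ-reaches-zero j (s≤s ()) | + suc (suc _)
  κ-reaches-zero j (s≤s ()) | -[1+ suc _ ]

  zero-step : ∀ j → κ j ≡ + 0 → (κ (suc j) ≡ + 0) × (u j ≡ v j)
  zero-step j e = from-0 (u j) (v j) (κ (suc j)) (κ-step-at j (+ 0) e)

  κ-stays-zero : ∀ J → κ J ≡ + 0 → ∀ m → (κ (m ℕ.+ J) ≡ + 0) × (u (m ℕ.+ J) ≡ v (m ℕ.+ J))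
  κ-stays-zero J e zero    = e , proj₂ (zero-step J e)
  κ-stays-zero J e (suc m) = let e' = proj₁ (zero-step (m ℕ.+ J) (proj₁ (κ-stays-zero J e m)))
                             in e' , proj₂ (zero-step (suc m ℕ.+ J) e')

  eventually-equal : Σ ℕ λ J → ∀ m → u (m ℕ.+ J) ≡ v (m ℕ.+ J)
  eventually-equal with κ-reaches-zero (∣ κ 0 ∣ ℕ.+ 0) (κ-becomes-small ∣ κ 0 ∣ 0 (ℕ.n≤1+n _))
  ... | n , e = n ℕ.+ (∣ κ 0 ∣ ℕ.+ 0) , λ m → proj₂ (κ-stays-zero _ e m)

pair-encode : (ℕ → Bool) → ℕ → Bool
pair-encode a zero          = a 0
pair-encode a (suc zero)    = not (a 0)
pair-encode a (suc (suc j)) = pair-encode (λ i → a (suc i)) j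

pair-encode-no-run : ∀ a → NoRun3 (pair-encode a)
pair-encode-no-run a zero       (e , _) = Bool.not-¬ refl e
pair-encode-no-run a (suc zero) (_ , e) = Bool.not-¬ refl e
pair-encode-no-run a (suc (suc j)) = pair-encode-no-run (λ i → a (suc i)) j

pair-encode-even : ∀ a i → pair-encode a (i ℕ.+ i) ≡ a i
pair-encode-even a zero    = refl
pair-encode-even a (suc i) rewrite ℕ.+-suc i i = pair-encode-even (λ k → a (suc k)) i

-- sweep = 0, 0 1, 0 1 2, …: every number is visited after any given time.
sweep-step : ℕ × ℕ → ℕ × ℕ
sweep-step (n , l) = if n <ᵇ l then (suc n , l) else (0 , suc l)

sweep-state : ℕ → ℕ × ℕ
sweep-state zero    = 0 , 0
sweep-state (suc i) = sweep-step (sweep-state i)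

sweep : ℕ → ℕ
sweep i = proj₁ (sweep-state i)

triangle : ℕ → ℕ
triangle zero    = 0
triangle (suc l) = triangle l ℕ.+ suc l

<ᵇ-< : ∀ n l → n < l → (n <ᵇ l) ≡ true
<ᵇ-< zero    (suc l) _         = refl
<ᵇ-< (suc n) (suc l) (s≤s n<l) = <ᵇ-< n l n<l

<ᵇ-irrefl : ∀ n → (n <ᵇ n) ≡ false
<ᵇ-irrefl zero    = refl
<ᵇ-irrefl (suc n) = <ᵇ-irrefl n

sweep-state-at : ∀ l n → n ≤ l → sweep-state (n ℕ.+ triangle l) ≡ (n , l)
sweep-state-at zero    zero    _   = refl
sweep-state-at (suc l) zero    _   = begin
  sweep-state (triangle l ℕ.+ suc l)   ≡⟨ cong sweep-state (trans (ℕ.+-suc (triangle l) l) (cong suc (ℕ.+-comm (triangle l) l))) ⟩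
  sweep-step (sweep-state (l ℕ.+ triangle l)) ≡⟨ cong sweep-step (sweep-state-at l l ℕ.≤-refl) ⟩
  sweep-step (l , l)                   ≡⟨ cong (if_then (suc l , l) else (0 , suc l)) (<ᵇ-irrefl l) ⟩
  (0 , suc l)                          ∎
  where open ≡-Reasoning
sweep-state-at l       (suc n) n<l = begin
  sweep-step (sweep-state (n ℕ.+ triangle l)) ≡⟨ cong sweep-step (sweep-state-at l n (ℕ.<⇒≤ n<l)) ⟩
  sweep-step (n , l)                   ≡⟨ cong (if_then (suc n , l) else (0 , suc l)) (<ᵇ-< n l n<l) ⟩
  (suc n , l)                          ∎
  where open ≡-Reasoning

sweep-visits : ∀ n I → Σ ℕ λ i → (I ≤ i) × (sweep i ≡ n)
sweep-visits n I = n ℕ.+ triangle (n ℕ.+ I) ,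
  ℕ.≤-trans (ℕ.m≤n+m I n) (ℕ.≤-trans (triangle-≥ (n ℕ.+ I)) (ℕ.m≤n+m _ n)) ,
  cong proj₁ (sweep-state-at (n ℕ.+ I) n (ℕ.m≤m+n n I))
  where
    triangle-≥ : ∀ l → l ≤ triangle l
    triangle-≥ zero    = z≤n
    triangle-≥ (suc l) = ℕ.m≤n+m (suc l) (triangle l)

-- Fix a decomposition of the complete folding sequence S.  For
-- each α realise offsets encoding α (each α n repeatedly) with signs chosen
-- so that the invariant is that of S: the results are locally isomorphic to
-- S, and an isomorphism between two of them makes the offsets eventually
-- equal, hence the points of Cantor space equal.

module Realisations (S : Seq) (complete : IsCompleteFolding S) where

  decomposition : Decomposition S
  decomposition = decompose S (complete⇒locally-canonical S complete)

  offsets : Cantor → ℕ → Bool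
  offsets α = pair-encode (λ i → α (sweep i))

  signs : Cantor → ℕ → Sign
  signs α j = invariant decomposition j · alt (bit (offsets α (suc j)))

  module R (α : Cantor) = Realise (offsets α) (pair-encode-no-run _) (signs α)

  G : Cantor → Seq
  G α = R.level α 0

  same-invariant : ∀ α j → invariant (R.realisation α) j ≡ invariant decomposition j
  same-invariant α j = begin
    (invariant decomposition j · a) · a ≡⟨ Sign.*-assoc (invariant decomposition j) a a ⟩
    invariant decomposition j · (a · a) ≡⟨ cong (invariant decomposition j ·_) (Sign.s*s≡+ a) ⟩
    invariant decomposition j · Sign.+  ≡⟨ Sign.*-identityʳ _ ⟩
    invariant decomposition j           ∎
    where
      open ≡-Reasoning
      a = alt (bit (offsets α (suc j)))

  G-locally-isomorphic : ∀ α → LocallyIsomorphic (G α) S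
  G-locally-isomorphic α = same-invariant⇒locally-isomorphic (R.realisation α) decomposition (same-invariant α)

  G-distinct : ∀ α β → Isomorphic (G α) (G β) → α ≈c β
  G-distinct α β (k , iso) n = from-eventual (eventually-equal (offsets α) (offsets β) (pair-encode-no-run _) κ κ-step)
    where
      open Shift.Descent (R.realisation α) (R.realisation β) k iso
      open ShiftDynamics using (eventually-equal)
      from-eventual : (Σ ℕ λ J → ∀ m → offsets α (m ℕ.+ J) ≡ offsets β (m ℕ.+ J)) → α n ≡ β n
      from-eventual (J , equal) with sweep-visits n J
      ... | i , J≤i , visits = begin
        α n                  ≡⟨ cong α visits ⟨
        α (sweep i)          ≡⟨ pair-encode-even (λ i → α (sweep i)) i ⟨
        offsets α (i ℕ.+ i)  ≡⟨ subst (λ z → offsets α z ≡ offsets β z) (ℕ.m∸n+n≡m J≤2i) (equal (i ℕ.+ i ∸ J)) ⟩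
        offsets β (i ℕ.+ i)  ≡⟨ pair-encode-even (λ i → β (sweep i)) i ⟩
        β (sweep i)          ≡⟨ cong β visits ⟩
        β n                  ∎
        where
          open ≡-Reasoning
          J≤2i : J ≤ i ℕ.+ i
          J≤2i = ℕ.≤-trans J≤i (ℕ.m≤m+n i i)

theorem1p11 :
    (Σ (Cantor → Seq) λ F →
        (∀ α → IsCompleteFolding (F α))
      × (∀ α β → LocallyIsomorphic (F α) (F β) → α ≈c β))
    × (∀ (S : Seq) → IsCompleteFolding S →
        Σ (Cantor → Seq) λ G →
            (∀ α → LocallyIsomorphic (G α) S)
          × (∀ α β → Isomorphic (G α) (G β) → α ≈c β))
theorem1p11 =
  (canonical-family , (λ α → canon-complete (λ n → toSign (α n))) , canonical-family-distinct) ,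
  λ S complete → let open Realisations S complete in G , G-locally-isomorphic , G-distinct
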